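{- Let $G=(V,E)$ be a connected undirected graph with $n=|V|\ge2$, and let $f:2^V\to\mathbb{R}$ be $f(X)=3^{n-2}-\sum_{C\in\mathcal{C}^*(X)}3^{|C|-2}$, where $\mathcal{C}^*(X)$ is the set of vertex sets of connected components of $G-X$ with at least two vertices. Then the base polytope $\mathbf{B}(f)=\{x\in\mathbb{R}^V: x(X)\le f(X)\ \forall X\subseteq V,\ x(V)=f(V)\}$ coincides with the convex hull of $\mathcal{E}=\{x^T : T \text{ an elimination tree of } G\}$.
   Context: Here $x(X)=\sum_{u\in X}x(u)$. An elimination tree of a connected graph $G$ is a rooted tree on $V$: a root $v$ which has, as children, the roots of elimination trees of each connected component of $G-v$. For an elimination tree $T$ and $v\in V$, let $T(v)$ be the vertex set of the subtree of $T$ rooted at $v$. The vector $x^T\in\mathbb{R}^V$ is defined from the leaves to the root: $x^T(v)=0$ if $v$ is a leaf of $T$; otherwise $x^T(v)$ is chosen so that $\sum_{u\in T(v)}x^T(u)=3^{|T(v)|-2}$.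
   Formalization: The base polytope $\mathbf{B}(f)$ and the convex hull of $\mathcal{E}$ are compared only at points with rational coordinates, using rational convex weights, rather than on all of $\mathbb{R}^V$. -}

module Defs where

open import Data.Nat using (ℕ; zero; suc; _^_)
open import Data.Bool using (Bool; true; false; if_then_else_; T)
open import Data.Fin using (Fin)
open import Data.Fin.Subset using (Subset; _∈_; _∩_; ∁; ⁅_⁆; ⊤; ∣_∣)
open import Data.Vec using (lookup)
open import Data.List using (List; []; _∷_)
open import Data.List.Relation.Unary.All using (All; []; _∷_)
open import Data.List.Relation.Unary.Unique.Propositional using (Unique)
open import Data.List.Membership.Propositional using () renaming (_∈_ to _∈ₗ_)
open import Data.Integer using (+_)
open import Data.Rational using (ℚ; _/_; 0ℚ; 1ℚ; _+_; _-_; _*_; _≤_)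
open import Data.Product using (Σ; ∃; _×_; _,_)
open import Function.Bundles using (_⇔_)
open import Relation.Binary.PropositionalEquality using (_≡_)

record Graph (n : ℕ) : Set where
  field
    adj    : Fin n → Fin n → Bool
    sym    : ∀ u v → adj u v ≡ adj v u
    irrefl : ∀ v → adj v v ≡ false
open Graph public

module _ {n : ℕ} (G : Graph n) where

  data Reach (W : Subset n) : Fin n → Fin n → Set where
    here : ∀ {u} → u ∈ W → Reach W u u
    step : ∀ {u v w} → u ∈ W → T (adj G u v) → Reach W v w → Reach W u w

  Connected : Set
  Connected = ∀ u v → Reach ⊤ u v

  IsComponent : Subset n → Subset n → Set
  IsComponent W C = (∃ λ u → u ∈ C) × (∀ u → u ∈ C → ∀ v → (v ∈ C ⇔ Reach W u v))

  Components : Subset n → List (Subset n) → Set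
  Components W cs =
    All (IsComponent W) cs × (∀ C → IsComponent W C → C ∈ₗ cs) × Unique cs

  data ElimTree (S : Subset n) : Set where
    node : (v : Fin n) → v ∈ S → (cs : List (Subset n)) →
           Components (S ∩ ∁ ⁅ v ⁆) cs → All ElimTree cs → ElimTree S

-- w k = 3^(k-2) if k ≥ 2, and 0 otherwise (size-1 components/leaves contribute 0).
w : ℕ → ℚ
w (suc (suc k)) = (+ (3 ^ k)) / 1
w _ = 0ℚ

sumW : {n : ℕ} → List (Subset n) → ℚ
sumW [] = 0ℚ
sumW (C ∷ cs) = w ∣ C ∣ + sumW cs

sumFin : {n : ℕ} → (Fin n → ℚ) → ℚ
sumFin {zero} x = 0ℚ
sumFin {suc n} x = x Fin.zero + sumFin (λ i → x (Fin.suc i))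
  where import Data.Fin as Fin

_⟨_⟩ : {n : ℕ} → (Fin n → ℚ) → Subset n → ℚ
x ⟨ X ⟩ = sumFin (λ u → if lookup X u then x u else 0ℚ)

-- f(X) = 3^(n-2) - Σ_{C ∈ C*(X)} 3^(|C|-2), where cs lists the components of G - X.
fval : {n : ℕ} → List (Subset n) → ℚ
fval {n} cs = w n - sumW cs

module _ {n : ℕ} (G : Graph n) where
  open import Data.Fin using (_≟_)
  open import Relation.Nullary using (yes; no)

  -- At the node with subtree vertex set S and children with
  -- vertex sets cs, x^T(v) = 3^(|S|-2) - Σ_{children C, |C| ≥ 2} 3^(|C|-2)
  -- (= 0 at a leaf), so that x^T(T(v)) = 3^(|T(v)|-2) for non-leaves.
  mutual
    xT : {S : Subset n} → ElimTree G S → Fin n → ℚ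
    xT {S} (node v _ cs _ ts) u with u ≟ v
    ... | yes _ = w ∣ S ∣ - sumW cs
    ... | no _  = xTs ts u

    xTs : {cs : List (Subset n)} → All (ElimTree G) cs → Fin n → ℚ
    xTs [] u = 0ℚ
    xTs (t ∷ ts) u = xT t u + xTs ts u

  InBase : (Fin n → ℚ) → Set
  InBase x =
    (∀ X cs → Components G (∁ X) cs → x ⟨ X ⟩ ≤ fval cs) ×
    (∀ cs → Components G (∁ ⊤) cs → x ⟨ ⊤ ⟩ ≡ fval cs)

  combo : List (ℚ × ElimTree G ⊤) → Fin n → ℚ
  combo [] u = 0ℚ
  combo ((λ₀ , t) ∷ ps) u = λ₀ * xT t u + combo ps u

  weights : List (ℚ × ElimTree G ⊤) → ℚ
  weights [] = 0ℚ
  weights ((λ₀ , _) ∷ ps) = λ₀ + weights ps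

  InConvHull : (Fin n → ℚ) → Set
  InConvHull x = Σ (List (ℚ × ElimTree G ⊤)) λ ps →
    All (λ p → 0ℚ ≤ Data.Product.proj₁ p) ps × weights ps ≡ 1ℚ × (∀ u → x u ≡ combo ps u)
    where import Data.Product

{-# OPTIONS --safe #-}
module Submission where

-- x^T lies in B(f) by induction on T. Consider the subtree rooted at v, with k = |T(v)|. If v ∈ X,
-- the bound on x^T(X) follows from the bounds for the subtrees below v, because the components of
-- T(v) - X are exactly the components of the sets C - X for the components C of T(v) - v. If X
-- misses T(v), both sides vanish. If X meets T(v) but not v, a crude estimate suffices, because
-- 3^(k-2) ≥ 2 · 3^(k-3).
--
-- Conversely, every point x of a base polytope B(g) with g(∅) = 0 is a convex combination of
-- greedy vectors of g: moving x along e_u - e_v in both directions until some set separating u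
-- from v becomes tight writes x as a convex combination of two points having a tight set A, and a
-- tight set splits B(g) into B(g on A) × B(g contracted by A), to which induction applies. A
-- greedy vector of f whose order starts at v is, after v, a greedy vector of the contraction of f
-- by v, which up to a constant is the sum of f over the components of G - v. So the greedy order
-- splits into greedy orders of the components, and recursively the greedy vector is x^T for the
-- elimination tree with root v.

open import Algebra.Bundles using (CommutativeMonoid)
open import Data.Bool using (true; false; if_then_else_; T)
import Data.Bool as Bool
open import Data.Empty using (⊥-elim)
open import Data.Fin as Fin using (Fin; _≟_)
import Data.Fin.Properties as FinP
open import Data.Fin.Subset using (Subset; _∈_; _∉_; _∩_; _∪_; ∁; ⁅_⁆; ⊤; ⊥; ∣_∣; _⊆_; _⊂_; Empty)
open import Data.Fin.Subset.Induction using (⊂-wellFounded)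
import Data.Fin.Subset.Properties as SP
import Data.Integer as ℤ
import Data.Integer.Properties as ℤP
open import Data.List as List using (List; []; _∷_)
open import Data.List.Membership.Propositional using () renaming (_∈_ to _∈ₗ_)
import Data.List.Membership.Propositional.Properties as ListMemP
open import Data.List.Membership.Propositional.Properties.WithK using (unique∧set⇒bag)
open import Data.List.Relation.Binary.BagAndSetEquality using (∼bag⇒↭)
open import Data.List.Relation.Binary.Permutation.Propositional using (_↭_; ↭⇒↭ₛ)
import Data.List.Relation.Binary.Permutation.Propositional.Properties as PermutationP
open import Data.List.Relation.Unary.All as All using (All; []; _∷_)
import Data.List.Relation.Unary.All.Properties as AllP
open import Data.List.Relation.Unary.AllPairs using (AllPairs; []; _∷_)
open import Data.List.Relation.Unary.Any using (here; there)
open import Data.Nat as ℕ using (ℕ; _≤_; zero; suc)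
import Data.Nat.Coprimality as Coprime
import Data.Nat.Properties as ℕP
open import Data.Product using (Σ; ∃; _×_; _,_; proj₁; proj₂; swap)
open import Data.Rational
  using (ℚ; mkℚ; toℚᵘ; *≤*; NonZero; nonNegative; positive; 1/_; _/_; 0ℚ; 1ℚ; _+_; _-_; _*_; -_; _<_)
  renaming (_≤_ to _≤ℚ_)
import Data.Rational.Properties as QP
open import Data.Rational.Solver using (module +-*-Solver)
import Data.Rational.Unnormalised as ℚᵘ
import Data.Rational.Unnormalised.Properties as ℚᵘP
open import Data.Sum using (_⊎_; inj₁; inj₂; [_,_]′)
open import Data.Vec as Vec using ([]; _∷_; lookup)
import Data.Vec.Properties as VecP
open import Defs hiding (sym)
open import Function using (_∘_; id)
open import Function.Bundles using (_⇔_; mk⇔; Equivalence)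
open import Induction.WellFounded using (Acc; acc)
open import Relation.Binary.Bundles using (DecTotalOrder)
open import Relation.Binary.PropositionalEquality
open import Relation.Nullary using (¬_; Dec; yes; no; does)
open import Relation.Nullary.Decidable using (map′; T?; _×-dec_; ¬?; dec-true; toSum)

open import Algebra.Properties.CommutativeSemigroup
  (CommutativeMonoid.commutativeSemigroup QP.+-0-commutativeMonoid) using (interchange)
open import Data.List.Extrema (DecTotalOrder.totalOrder QP.≤-decTotalOrder)
  using (argmin; argmin-all; f[argmin]≤f[xs])
import Data.List.Relation.Binary.Permutation.Setoid.Properties (setoid ℚ) as PermutationₛP
open +-*-Solver using (solve; _:+_; _:-_; _:*_; _:=_; con; :-_)

module _ {n : ℕ} where

  infixl 7 _∖_
  _∖_ : Subset n → Subset n → Subset n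
  p ∖ q = p ∩ ∁ q

  module _ {p q : Subset n} {x : Fin n} where

    ∩⁺ : x ∈ p → x ∈ q → x ∈ p ∩ q
    ∩⁺ x∈p x∈q = SP.x∈p∩q⁺ (x∈p , x∈q)

    ∩⁻ : x ∈ p ∩ q → x ∈ p × x ∈ q
    ∩⁻ = SP.x∈p∩q⁻ p q

    ∪⁺ˡ : x ∈ p → x ∈ p ∪ q
    ∪⁺ˡ x∈p = SP.x∈p∪q⁺ (inj₁ x∈p)

    ∪⁺ʳ : x ∈ q → x ∈ p ∪ q
    ∪⁺ʳ x∈q = SP.x∈p∪q⁺ (inj₂ x∈q)

    ∪⁻ : x ∈ p ∪ q → x ∈ p ⊎ x ∈ q
    ∪⁻ = SP.x∈p∪q⁻ p q

    ∖⁺ : x ∈ p → x ∉ q → x ∈ p ∖ q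
    ∖⁺ x∈p x∉q = SP.x∈p∩q⁺ (x∈p , SP.x∉p⇒x∈∁p x∉q)

    ∖⁻ : x ∈ p ∖ q → x ∈ p × x ∉ q
    ∖⁻ x∈p∖q with SP.x∈p∩q⁻ p (∁ q) x∈p∖q
    ... | x∈p , x∈∁q = x∈p , SP.x∈∁p⇒x∉p x∈∁q

  ∖-⊆ : ∀ {p q : Subset n} → p ∖ q ⊆ p
  ∖-⊆ = proj₁ ∘ ∖⁻

  ∖-⊂ : ∀ {p q : Subset n} {x} → x ∈ p → x ∈ q → p ∖ q ⊂ p
  ∖-⊂ x∈p x∈q = ∖-⊆ , _ , x∈p , λ x∈p∖q → proj₂ (∖⁻ x∈p∖q) x∈q

  ⁅⁆-⊆ : ∀ {p : Subset n} {x} → x ∈ p → ⁅ x ⁆ ⊆ p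
  ⁅⁆-⊆ {x = x} x∈p y∈⁅x⁆ rewrite SP.x∈⁅y⁆⇒x≡y x y∈⁅x⁆ = x∈p

  p∖⊥≡p : ∀ (p : Subset n) → p ∖ ⊥ ≡ p
  p∖⊥≡p p = SP.⊆-antisym ∖-⊆ (λ x∈p → ∖⁺ x∈p SP.∉⊥)

  ⊆⇒∩≡ : ∀ {p q : Subset n} → q ⊆ p → p ∩ q ≡ q
  ⊆⇒∩≡ q⊆p = SP.⊆-antisym (proj₂ ∘ ∩⁻) (λ x∈q → ∩⁺ (q⊆p x∈q) x∈q)

  ⊆⇒∖∪≡ : ∀ {p q : Subset n} → q ⊆ p → (p ∖ q) ∪ q ≡ p
  ⊆⇒∖∪≡ {p} {q} q⊆p = SP.⊆-antisym
    (λ m → [ ∖-⊆ , q⊆p ]′ (∪⁻ m))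
    (λ {x} x∈p → [ ∪⁺ʳ , ∪⁺ˡ ∘ ∖⁺ x∈p ]′ (toSum (x SP.∈? q)))

  Disjoint : Subset n → Subset n → Set
  Disjoint p q = ∀ {x} → x ∈ p → x ∉ q

  ∈⇒lookup≡true : ∀ {p : Subset n} {x} → x ∈ p → lookup p x ≡ true
  ∈⇒lookup≡true = VecP.[]=⇒lookup

  lookup≡true⇒∈ : ∀ {p : Subset n} {x} → lookup p x ≡ true → x ∈ p
  lookup≡true⇒∈ {p} {x} = VecP.lookup⇒[]= x p

  ∉⇒lookup≡false : ∀ {p : Subset n} {x} → x ∉ p → lookup p x ≡ false
  ∉⇒lookup≡false {p} {x} x∉p with lookup p x in eq
  ... | true  = ⊥-elim (x∉p (lookup≡true⇒∈ eq))
  ... | false = refl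

  ⋃ : List (Subset n) → Subset n
  ⋃ = List.foldr _∪_ ⊥

  ∈-⋃⁺ : ∀ {cs C x} → C ∈ₗ cs → x ∈ C → x ∈ ⋃ cs
  ∈-⋃⁺ (here refl)  x∈C = ∪⁺ˡ x∈C
  ∈-⋃⁺ (there C∈cs) x∈C = ∪⁺ʳ (∈-⋃⁺ C∈cs x∈C)

  ∈-⋃⁻ : ∀ cs {x} → x ∈ ⋃ cs → ∃ λ C → C ∈ₗ cs × x ∈ C
  ∈-⋃⁻ []       x∈⊥ = ⊥-elim (SP.∉⊥ x∈⊥)
  ∈-⋃⁻ (C ∷ cs) x∈⋃ with ∪⁻ x∈⋃
  ... | inj₁ x∈C  = C , here refl , x∈C
  ... | inj₂ x∈cs with ∈-⋃⁻ cs x∈cs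
  ...   | D , D∈cs , x∈D = D , there D∈cs , x∈D

  ⋃-⊆ : ∀ {cs W} → All (_⊆ W) cs → ⋃ cs ⊆ W
  ⋃-⊆ {cs} cs⊆W x∈⋃cs with ∈-⋃⁻ cs x∈⋃cs
  ... | C , C∈cs , x∈C = All.lookup cs⊆W C∈cs x∈C

  Disjoint-⋃ : ∀ {C : Subset n} {cs} → All (Disjoint C) cs → Disjoint C (⋃ cs)
  Disjoint-⋃ {cs = cs} C#cs x∈C x∈⋃cs with ∈-⋃⁻ cs x∈⋃cs
  ... | D , D∈cs , x∈D = All.lookup C#cs D∈cs x∈C x∈D

∣p∣≡∣q∣+∣p∖q∣ : ∀ {n} {p q : Subset n} → q ⊆ p → ∣ p ∣ ≡ ∣ q ∣ ℕ.+ ∣ p ∖ q ∣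
∣p∣≡∣q∣+∣p∖q∣ {p = []}        {[]}        _   = refl
∣p∣≡∣q∣+∣p∖q∣ {p = true ∷ p}  {true ∷ q}  q⊆p = cong suc (∣p∣≡∣q∣+∣p∖q∣ (SP.drop-∷-⊆ q⊆p))
∣p∣≡∣q∣+∣p∖q∣ {p = true ∷ p}  {false ∷ q} q⊆p =
  trans (cong suc (∣p∣≡∣q∣+∣p∖q∣ (SP.drop-∷-⊆ q⊆p))) (sym (ℕP.+-suc _ _))
∣p∣≡∣q∣+∣p∖q∣ {p = false ∷ p} {false ∷ q} q⊆p = ∣p∣≡∣q∣+∣p∖q∣ (SP.drop-∷-⊆ q⊆p)
∣p∣≡∣q∣+∣p∖q∣ {p = false ∷ p} {true ∷ q}  q⊆p with q⊆p Vec.here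
... | ()

∣p∣≡1+∣p∖⁅x⁆∣ : ∀ {n} {p : Subset n} {x} → x ∈ p → ∣ p ∣ ≡ suc ∣ p ∖ ⁅ x ⁆ ∣
∣p∣≡1+∣p∖⁅x⁆∣ {p = p} {x} x∈p =
  trans (∣p∣≡∣q∣+∣p∖q∣ (⁅⁆-⊆ x∈p)) (cong (ℕ._+ ∣ p ∖ ⁅ x ⁆ ∣) (SP.∣⁅x⁆∣≡1 x))

sumFin-cong : ∀ {n} {f g : Fin n → ℚ} → (∀ u → f u ≡ g u) → sumFin f ≡ sumFin g
sumFin-cong {zero}  f≗g = refl
sumFin-cong {suc n} f≗g = cong₂ _+_ (f≗g Fin.zero) (sumFin-cong (f≗g ∘ Fin.suc))

sumFin-+ : ∀ {n} (f g : Fin n → ℚ) → sumFin (λ u → f u + g u) ≡ sumFin f + sumFin g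
sumFin-+ {zero}  f g = sym (QP.+-identityˡ 0ℚ)
sumFin-+ {suc n} f g =
  trans (cong ((f Fin.zero + g Fin.zero) +_) (sumFin-+ (f ∘ Fin.suc) (g ∘ Fin.suc)))
        (interchange (f Fin.zero) (g Fin.zero) (sumFin (f ∘ Fin.suc)) (sumFin (g ∘ Fin.suc)))

sumFin-* : ∀ {n} c (f : Fin n → ℚ) → sumFin (λ u → c * f u) ≡ c * sumFin f
sumFin-* {zero}  c f = sym (QP.*-zeroʳ c)
sumFin-* {suc n} c f =
  trans (cong (c * f Fin.zero +_) (sumFin-* c (f ∘ Fin.suc))) (sym (QP.*-distribˡ-+ c _ _))

sumFin-0 : ∀ {n} → sumFin {n} (λ _ → 0ℚ) ≡ 0ℚ
sumFin-0 {zero}  = refl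
sumFin-0 {suc n} = trans (QP.+-identityˡ _) (sumFin-0 {n})

δ : ∀ {n} → Fin n → ℚ → Fin n → ℚ
δ v c u = if does (u ≟ v) then c else 0ℚ

δ-diag : ∀ {n} (v : Fin n) c → δ v c v ≡ c
δ-diag v c with v ≟ v
... | yes _   = refl
... | no v≢v = ⊥-elim (v≢v refl)

δ-off : ∀ {n} {v u : Fin n} c → u ≢ v → δ v c u ≡ 0ℚ
δ-off {v = v} {u} c u≢v with u ≟ v
... | yes u≡v = ⊥-elim (u≢v u≡v)
... | no _    = refl

δ-0 : ∀ {n} (v w : Fin n) → δ v 0ℚ w ≡ 0ℚ
δ-0 v w with w ≟ v
... | yes _ = refl
... | no _  = refl

δ-linear : ∀ {n} a b (v : Fin n) c d w → a * δ v c w + b * δ v d w ≡ δ v (a * c + b * d) w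
δ-linear a b v c d w with w ≟ v
... | yes _ = refl
... | no _  = solve 2 (λ a b → a :* con 0ℚ :+ b :* con 0ℚ := con 0ℚ) refl a b

sumFin-δ : ∀ {n} (v : Fin n) c → sumFin (δ v c) ≡ c
sumFin-δ {suc n} Fin.zero    c = trans (cong (c +_) (sumFin-0 {n})) (QP.+-identityʳ c)
sumFin-δ {suc n} (Fin.suc v) c = trans (QP.+-identityˡ _) (sumFin-δ v c)

module _ {n : ℕ} where

  infixl 8 _↾_
  _↾_ : (Fin n → ℚ) → Subset n → Fin n → ℚ
  (x ↾ X) u = if lookup X u then x u else 0ℚ

  ⟨⟩-cong : ∀ {x y : Fin n → ℚ} X → (∀ {u} → u ∈ X → x u ≡ y u) → x ⟨ X ⟩ ≡ y ⟨ X ⟩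
  ⟨⟩-cong {x} {y} X x≗y = sumFin-cong pointwise
    where
    pointwise : ∀ u → (x ↾ X) u ≡ (y ↾ X) u
    pointwise u with lookup X u in eq
    ... | true  = x≗y (lookup≡true⇒∈ eq)
    ... | false = refl

  ⟨⟩-≡0 : ∀ {x : Fin n → ℚ} X → (∀ {u} → u ∈ X → x u ≡ 0ℚ) → x ⟨ X ⟩ ≡ 0ℚ
  ⟨⟩-≡0 {x} X x≗0 = trans (sumFin-cong pointwise) (sumFin-0 {n})
    where
    pointwise : ∀ u → (x ↾ X) u ≡ 0ℚ
    pointwise u with lookup X u in eq
    ... | true  = x≗0 (lookup≡true⇒∈ eq)
    ... | false = refl

  ⟨⟩-+ : ∀ (x y : Fin n → ℚ) X → (λ u → x u + y u) ⟨ X ⟩ ≡ x ⟨ X ⟩ + y ⟨ X ⟩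
  ⟨⟩-+ x y X = trans (sumFin-cong pointwise) (sumFin-+ (x ↾ X) (y ↾ X))
    where
    pointwise : ∀ u → ((λ u → x u + y u) ↾ X) u ≡ (x ↾ X) u + (y ↾ X) u
    pointwise u with lookup X u
    ... | true  = refl
    ... | false = sym (QP.+-identityˡ 0ℚ)

  ⟨⟩-* : ∀ c (x : Fin n → ℚ) X → (λ u → c * x u) ⟨ X ⟩ ≡ c * x ⟨ X ⟩
  ⟨⟩-* c x X = trans (sumFin-cong pointwise) (sumFin-* c (x ↾ X))
    where
    pointwise : ∀ u → ((λ u → c * x u) ↾ X) u ≡ c * (x ↾ X) u
    pointwise u with lookup X u
    ... | true  = refl
    ... | false = sym (QP.*-zeroʳ c)

  ⟨⟩-split : ∀ (x : Fin n → ℚ) Y C → x ⟨ Y ⟩ ≡ x ⟨ Y ∩ C ⟩ + x ⟨ Y ∖ C ⟩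
  ⟨⟩-split x Y C = trans (sumFin-cong pointwise) (sumFin-+ (x ↾ (Y ∩ C)) (x ↾ (Y ∖ C)))
    where
    pointwise : ∀ u → (x ↾ Y) u ≡ (x ↾ (Y ∩ C)) u + (x ↾ (Y ∖ C)) u
    pointwise u rewrite VecP.lookup-zipWith Bool._∧_ u Y C
                      | VecP.lookup-zipWith Bool._∧_ u Y (∁ C)
                      | VecP.lookup-map u Bool.not C
                      with lookup Y u | lookup C u
    ... | true  | true  = sym (QP.+-identityʳ _)
    ... | true  | false = sym (QP.+-identityˡ _)
    ... | false | _     = sym (QP.+-identityˡ 0ℚ)

  ⟨⟩-∪-disjoint : ∀ (x : Fin n → ℚ) {X A} → Disjoint X A → x ⟨ X ∪ A ⟩ ≡ x ⟨ X ⟩ + x ⟨ A ⟩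
  ⟨⟩-∪-disjoint x {X} {A} X#A = begin
    x ⟨ X ∪ A ⟩                             ≡⟨ ⟨⟩-split x (X ∪ A) A ⟩
    x ⟨ (X ∪ A) ∩ A ⟩ + x ⟨ (X ∪ A) ∖ A ⟩  ≡⟨ cong₂ (λ P Q → x ⟨ P ⟩ + x ⟨ Q ⟩) (⊆⇒∩≡ (∪⁺ʳ {p = X})) X∪A∖A≡X ⟩
    x ⟨ A ⟩ + x ⟨ X ⟩                       ≡⟨ QP.+-comm (x ⟨ A ⟩) (x ⟨ X ⟩) ⟩
    x ⟨ X ⟩ + x ⟨ A ⟩                       ∎
    where
    open ≡-Reasoning
    X∪A∖A≡X : (X ∪ A) ∖ A ≡ X
    X∪A∖A≡X = SP.⊆-antisym
      (λ m → [ id , (λ u∈A → ⊥-elim (proj₂ (∖⁻ m) u∈A)) ]′ (∪⁻ (∖-⊆ m)))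
      (λ u∈X → ∖⁺ (∪⁺ˡ u∈X) (X#A u∈X))

  ⟨⟩-δ-∈ : ∀ {v : Fin n} {X} c → v ∈ X → (δ v c) ⟨ X ⟩ ≡ c
  ⟨⟩-δ-∈ {v} {X} c v∈X = trans (sumFin-cong pointwise) (sumFin-δ v c)
    where
    pointwise : ∀ u → (δ v c ↾ X) u ≡ δ v c u
    pointwise u with u ≟ v
    ... | yes refl rewrite ∈⇒lookup≡true v∈X = refl
    ... | no _ with lookup X u
    ...   | true  = refl
    ...   | false = refl

  ⟨⟩-δ-∉ : ∀ {v : Fin n} {X} c → v ∉ X → (δ v c) ⟨ X ⟩ ≡ 0ℚ
  ⟨⟩-δ-∉ {v} {X} c v∉X = ⟨⟩-≡0 X (λ {u} u∈X → δ-off {v = v} {u = u} c λ { refl → v∉X u∈X })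

  ⟨⟩-⁅⁆ : ∀ (x : Fin n → ℚ) u → x ⟨ ⁅ u ⁆ ⟩ ≡ x u
  ⟨⟩-⁅⁆ x u = trans (⟨⟩-cong ⁅ u ⁆ at-u) (⟨⟩-δ-∈ (x u) (SP.x∈⁅x⁆ u))
    where
    at-u : ∀ {w} → w ∈ ⁅ u ⁆ → x w ≡ δ u (x u) w
    at-u w∈⁅u⁆ rewrite SP.x∈⁅y⁆⇒x≡y u w∈⁅u⁆ = sym (δ-diag u (x u))

∑ : ∀ {A : Set} → List A → (A → ℚ) → ℚ
∑ []       f = 0ℚ
∑ (a ∷ as) f = f a + ∑ as f

∑-cong : ∀ {A : Set} (as : List A) {f g : A → ℚ} → (∀ a → f a ≡ g a) → ∑ as f ≡ ∑ as g
∑-cong []       f≗g = refl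
∑-cong (a ∷ as) f≗g = cong₂ _+_ (f≗g a) (∑-cong as f≗g)

∑-mono-≤ : ∀ {A : Set} {as : List A} {f g : A → ℚ} → All (λ a → f a ≤ℚ g a) as → ∑ as f ≤ℚ ∑ as g
∑-mono-≤ []           = QP.≤-refl
∑-mono-≤ (fa≤ga ∷ f≤g) = QP.+-mono-≤ fa≤ga (∑-mono-≤ f≤g)

∑-++ : ∀ {A : Set} (as bs : List A) f → ∑ (as List.++ bs) f ≡ ∑ as f + ∑ bs f
∑-++ []       bs f = sym (QP.+-identityˡ _)
∑-++ (a ∷ as) bs f = trans (cong (f a +_) (∑-++ as bs f)) (sym (QP.+-assoc (f a) _ _))

∑-map : ∀ {A B : Set} (h : A → B) (as : List A) f → ∑ (List.map h as) f ≡ ∑ as (f ∘ h)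
∑-map h []       f = refl
∑-map h (a ∷ as) f = cong (f (h a) +_) (∑-map h as f)

∑-cartesianProductWith : ∀ {A B C : Set} (h : A → B → C) (as : List A) (bs : List B) f →
  ∑ (List.cartesianProductWith h as bs) f ≡ ∑ as (λ a → ∑ bs (λ b → f (h a b)))
∑-cartesianProductWith h []       bs f = refl
∑-cartesianProductWith h (a ∷ as) bs f = trans (∑-++ (List.map (h a) bs) _ f)
  (cong₂ _+_ (∑-map (h a) bs f) (∑-cartesianProductWith h as bs f))

∑-*ˡ : ∀ {A : Set} c (as : List A) f → ∑ as (λ a → c * f a) ≡ c * ∑ as f
∑-*ˡ c []       f = sym (QP.*-zeroʳ c)
∑-*ˡ c (a ∷ as) f = trans (cong (c * f a +_) (∑-*ˡ c as f)) (sym (QP.*-distribˡ-+ c (f a) _))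

∑-*ʳ : ∀ {A : Set} c (as : List A) f → ∑ as (λ a → f a * c) ≡ ∑ as f * c
∑-*ʳ c as f = trans (∑-cong as (λ a → QP.*-comm (f a) c)) (trans (∑-*ˡ c as f) (QP.*-comm c _))

∑-− : ∀ {A : Set} (as : List A) (f g : A → ℚ) → ∑ as (λ a → f a - g a) ≡ ∑ as f - ∑ as g
∑-− []       f g = refl
∑-− (a ∷ as) f g = trans (cong (f a - g a +_) (∑-− as f g))
  (solve 4 (λ x y X Y → (x :- y) :+ (X :- Y) := (x :+ X) :- (y :+ Y)) refl (f a) (g a) (∑ as f) (∑ as g))

∑-nonneg : ∀ {A : Set} (as : List A) {f : A → ℚ} → (∀ a → 0ℚ ≤ℚ f a) → 0ℚ ≤ℚ ∑ as f
∑-nonneg []       0≤f = QP.≤-refl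
∑-nonneg (a ∷ as) 0≤f = QP.+-mono-≤ (0≤f a) (∑-nonneg as 0≤f)

sumW≡∑ : ∀ {n} (cs : List (Subset n)) → sumW cs ≡ ∑ cs (w ∘ ∣_∣)
sumW≡∑ []       = refl
sumW≡∑ (C ∷ cs) = cong (w ∣ C ∣ +_) (sumW≡∑ cs)

0≤1 : 0ℚ ≤ℚ 1ℚ
0≤1 = *≤* (ℤ.+≤+ ℕ.z≤n)

0≤* : ∀ {p q} → 0ℚ ≤ℚ p → 0ℚ ≤ℚ q → 0ℚ ≤ℚ p * q
0≤* {p} {q} 0≤p 0≤q = QP.nonNegative⁻¹ (p * q)
  {{QP.nonNeg*nonNeg⇒nonNeg p {{nonNegative 0≤p}} q {{nonNegative 0≤q}}}}

0≤⇒≡0⊎0< : ∀ {t} → 0ℚ ≤ℚ t → t ≡ 0ℚ ⊎ 0ℚ < t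
0≤⇒≡0⊎0< {t} 0≤t with t QP.≤? 0ℚ
... | yes t≤0 = inj₁ (QP.≤-antisym t≤0 0≤t)
... | no t≰0  = inj₂ (QP.≰⇒> t≰0)

p+q≤r⇒p≤r-q : ∀ {p q r} → p + q ≤ℚ r → p ≤ℚ r - q
p+q≤r⇒p≤r-q {p} {q} {r} p+q≤r = begin
  p             ≡⟨ solve 2 (λ p q → p := (p :+ q) :- q) refl p q ⟩
  (p + q) - q   ≤⟨ QP.+-monoˡ-≤ (- q) p+q≤r ⟩
  r - q         ∎
  where open QP.≤-Reasoning

p-q≤p-r : ∀ p {q r} → r ≤ℚ q → p - q ≤ℚ p - r
p-q≤p-r p r≤q = QP.+-monoʳ-≤ p (QP.neg-antimono-≤ r≤q)

p-q≤p : ∀ p {q} → 0ℚ ≤ℚ q → p - q ≤ℚ p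
p-q≤p p 0≤q = QP.≤-trans (p-q≤p-r p 0≤q) (QP.≤-reflexive (QP.+-identityʳ p))

ℕ→ℚ : ℕ → ℚ
ℕ→ℚ m = mkℚ (ℤ.+ m) 0 (Coprime.sym (Coprime.1-coprimeTo m))

/1≡ℕ→ℚ : ∀ m → ℤ.+ m / 1 ≡ ℕ→ℚ m
/1≡ℕ→ℚ m = QP.normalize-coprime (Coprime.sym (Coprime.1-coprimeTo m))

ℕ→ℚ-mono-≤ : ∀ {a b} → a ≤ b → ℕ→ℚ a ≤ℚ ℕ→ℚ b
ℕ→ℚ-mono-≤ {a} {b} a≤b =
  *≤* (subst₂ ℤ._≤_ (sym (ℤP.*-identityʳ (ℤ.+ a))) (sym (ℤP.*-identityʳ (ℤ.+ b))) (ℤ.+≤+ a≤b))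

ℕ→ℚ-+ : ∀ a b → ℕ→ℚ (a ℕ.+ b) ≡ ℕ→ℚ a + ℕ→ℚ b
ℕ→ℚ-+ a b = QP.toℚᵘ-injective (ℚᵘP.≃-trans numerators (ℚᵘP.≃-sym (QP.toℚᵘ-homo-+ (ℕ→ℚ a) (ℕ→ℚ b))))
  where
  numerators : toℚᵘ (ℕ→ℚ (a ℕ.+ b)) ℚᵘ.≃ toℚᵘ (ℕ→ℚ a) ℚᵘ.+ toℚᵘ (ℕ→ℚ b)
  numerators = ℚᵘ.*≡* (trans (ℤP.*-identityʳ _) (trans (ℤP.pos-+ a b)
    (sym (trans (ℤP.*-identityʳ _) (cong₂ ℤ._+_ (ℤP.*-identityʳ (ℤ.+ a)) (ℤP.*-identityʳ (ℤ.+ b)))))))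

wℕ : ℕ → ℕ
wℕ (suc (suc k)) = 3 ℕ.^ k
wℕ _             = 0

w≡ℕ→ℚ∘wℕ : ∀ k → w k ≡ ℕ→ℚ (wℕ k)
w≡ℕ→ℚ∘wℕ zero          = /1≡ℕ→ℚ 0
w≡ℕ→ℚ∘wℕ (suc zero)    = /1≡ℕ→ℚ 0
w≡ℕ→ℚ∘wℕ (suc (suc k)) = /1≡ℕ→ℚ (3 ℕ.^ k)

m+m≤3*m : ∀ m → m ℕ.+ m ≤ 3 ℕ.* m
m+m≤3*m m = ℕP.+-monoʳ-≤ m (ℕP.m≤m+n m _)

wℕ-double : ∀ k → wℕ k ℕ.+ wℕ k ≤ wℕ (suc k)
wℕ-double zero          = ℕ.z≤n
wℕ-double (suc zero)    = ℕ.z≤n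
wℕ-double (suc (suc k)) = m+m≤3*m (3 ℕ.^ k)

wℕ-mono-≤ : ∀ {a b} → a ≤ b → wℕ a ≤ wℕ b
wℕ-mono-≤ {zero}        _                     = ℕ.z≤n
wℕ-mono-≤ {suc zero}    _                     = ℕ.z≤n
wℕ-mono-≤ {suc (suc i)} (ℕ.s≤s (ℕ.s≤s i≤j)) = ℕP.^-monoʳ-≤ 3 i≤j

wℕ-superadditive : ∀ a b → wℕ a ℕ.+ wℕ b ≤ wℕ (a ℕ.+ b)
wℕ-superadditive zero          b             = ℕP.≤-refl
wℕ-superadditive (suc zero)    b             = wℕ-mono-≤ (ℕP.n≤1+n b)
wℕ-superadditive (suc (suc i)) zero          =
  ℕP.≤-reflexive (trans (ℕP.+-identityʳ _) (cong wℕ (sym (ℕP.+-identityʳ (suc (suc i))))))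
wℕ-superadditive (suc (suc i)) (suc zero)    =
  ℕP.≤-trans (ℕP.≤-reflexive (ℕP.+-identityʳ _)) (wℕ-mono-≤ (ℕP.m≤m+n (suc (suc i)) 1))
wℕ-superadditive (suc (suc i)) (suc (suc j)) = begin
  3 ℕ.^ i ℕ.+ 3 ℕ.^ j
    ≤⟨ ℕP.+-mono-≤ (ℕP.^-monoʳ-≤ 3 (ℕP.m≤m+n i j)) (ℕP.^-monoʳ-≤ 3 (ℕP.m≤n+m j i)) ⟩
  3 ℕ.^ (i ℕ.+ j) ℕ.+ 3 ℕ.^ (i ℕ.+ j)
    ≤⟨ m+m≤3*m (3 ℕ.^ (i ℕ.+ j)) ⟩
  3 ℕ.^ suc (i ℕ.+ j)
    ≤⟨ ℕP.^-monoʳ-≤ 3 (ℕP.≤-trans (ℕP.n≤1+n _) (ℕP.≤-reflexive i+j+2≡)) ⟩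
  3 ℕ.^ (i ℕ.+ suc (suc j)) ∎
  where
  open ℕP.≤-Reasoning
  i+j+2≡ : suc (suc (i ℕ.+ j)) ≡ i ℕ.+ suc (suc j)
  i+j+2≡ = sym (trans (ℕP.+-suc i (suc j)) (cong suc (ℕP.+-suc i j)))

module _ where
  open QP.≤-Reasoning

  w-nonneg : ∀ k → 0ℚ ≤ℚ w k
  w-nonneg k = begin
    0ℚ           ≡⟨ /1≡ℕ→ℚ 0 ⟩
    ℕ→ℚ 0        ≤⟨ ℕ→ℚ-mono-≤ ℕ.z≤n ⟩
    ℕ→ℚ (wℕ k)   ≡⟨ w≡ℕ→ℚ∘wℕ k ⟨
    w k          ∎

  w-mono-≤ : ∀ {a b} → a ≤ b → w a ≤ℚ w b
  w-mono-≤ {a} {b} a≤b = begin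
    w a          ≡⟨ w≡ℕ→ℚ∘wℕ a ⟩
    ℕ→ℚ (wℕ a)   ≤⟨ ℕ→ℚ-mono-≤ (wℕ-mono-≤ a≤b) ⟩
    ℕ→ℚ (wℕ b)   ≡⟨ w≡ℕ→ℚ∘wℕ b ⟨
    w b          ∎

  w-superadditive : ∀ a b → w a + w b ≤ℚ w (a ℕ.+ b)
  w-superadditive a b = begin
    w a + w b                 ≡⟨ cong₂ _+_ (w≡ℕ→ℚ∘wℕ a) (w≡ℕ→ℚ∘wℕ b) ⟩
    ℕ→ℚ (wℕ a) + ℕ→ℚ (wℕ b)   ≡⟨ ℕ→ℚ-+ (wℕ a) (wℕ b) ⟨
    ℕ→ℚ (wℕ a ℕ.+ wℕ b)       ≤⟨ ℕ→ℚ-mono-≤ (wℕ-superadditive a b) ⟩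
    ℕ→ℚ (wℕ (a ℕ.+ b))        ≡⟨ w≡ℕ→ℚ∘wℕ (a ℕ.+ b) ⟨
    w (a ℕ.+ b)               ∎

  w-double : ∀ k → w k + w k ≤ℚ w (suc k)
  w-double k = begin
    w k + w k                 ≡⟨ cong₂ _+_ (w≡ℕ→ℚ∘wℕ k) (w≡ℕ→ℚ∘wℕ k) ⟩
    ℕ→ℚ (wℕ k) + ℕ→ℚ (wℕ k)   ≡⟨ ℕ→ℚ-+ (wℕ k) (wℕ k) ⟨
    ℕ→ℚ (wℕ k ℕ.+ wℕ k)       ≤⟨ ℕ→ℚ-mono-≤ (wℕ-double k) ⟩
    ℕ→ℚ (wℕ (suc k))          ≡⟨ w≡ℕ→ℚ∘wℕ (suc k) ⟨
    w (suc k)                 ∎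

-- Walks and connected components

module _ {n : ℕ} (G : Graph n) where

  Reach-start : ∀ {W a b} → Reach G W a b → a ∈ W
  Reach-start (here a∈W)     = a∈W
  Reach-start (step a∈W _ _) = a∈W

  Reach-end : ∀ {W a b} → Reach G W a b → b ∈ W
  Reach-end (here b∈W)   = b∈W
  Reach-end (step _ _ r) = Reach-end r

  Reach-trans : ∀ {W a b c} → Reach G W a b → Reach G W b c → Reach G W a c
  Reach-trans (here _)       r = r
  Reach-trans (step a∈W e q) r = step a∈W e (Reach-trans q r)

  Reach-sym : ∀ {W a b} → Reach G W a b → Reach G W b a
  Reach-sym (here a∈W)     = here a∈W
  Reach-sym (step a∈W e r) =
    Reach-trans (Reach-sym r) (step (Reach-start r) (subst T (Graph.sym G _ _) e) (here a∈W))

  Reach-mono : ∀ {W W′} → W ⊆ W′ → ∀ {a b} → Reach G W a b → Reach G W′ a b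
  Reach-mono W⊆W′ (here a∈W)     = here (W⊆W′ a∈W)
  Reach-mono W⊆W′ (step a∈W e r) = step (W⊆W′ a∈W) e (Reach-mono W⊆W′ r)

  Reach-after-last-visit : ∀ {W a v} u → Reach G W a v → v ≢ u →
    Reach G (W ∖ ⁅ u ⁆) a v ⊎ ∃ λ u′ → T (adj G u u′) × Reach G (W ∖ ⁅ u ⁆) u′ v
  Reach-after-last-visit u (here v∈W) v≢u = inj₁ (here (∖⁺ v∈W (SP.x≢y⇒x∉⁅y⁆ v≢u)))
  Reach-after-last-visit u (step {a} {b} a∈W e r) v≢u with Reach-after-last-visit u r v≢u
  ... | inj₂ later = inj₂ later
  ... | inj₁ r′ with a ≟ u
  ...   | yes refl = inj₂ (b , e , r′)
  ...   | no a≢u   = inj₁ (step (∖⁺ a∈W (SP.x≢y⇒x∉⁅y⁆ a≢u)) e r′)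

  reach? : ∀ W u v → Dec (Reach G W u v)
  reach? W = go W (⊂-wellFounded W)
    where
    go : ∀ W → Acc _⊂_ W → ∀ u v → Dec (Reach G W u v)
    go W (acc rs) u v with u SP.∈? W
    ... | no u∉W = no (u∉W ∘ Reach-start)
    ... | yes u∈W with u ≟ v
    ...   | yes refl = yes (here u∈W)
    ...   | no u≢v   = map′ through-neighbour via-neighbour
                         (FinP.any? λ u′ → T? (adj G u u′) ×-dec go (W ∖ ⁅ u ⁆) (rs (∖-⊂ u∈W (SP.x∈⁅x⁆ u))) u′ v)
      where
      through-neighbour : (∃ λ u′ → T (adj G u u′) × Reach G (W ∖ ⁅ u ⁆) u′ v) → Reach G W u v
      through-neighbour (u′ , e , r) = step u∈W e (Reach-mono ∖-⊆ r)
      via-neighbour : Reach G W u v → ∃ λ u′ → T (adj G u u′) × Reach G (W ∖ ⁅ u ⁆) u′ v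
      via-neighbour r with Reach-after-last-visit u r (u≢v ∘ sym)
      ... | inj₁ r′    = ⊥-elim (proj₂ (∖⁻ (Reach-start r′)) (SP.x∈⁅x⁆ u))
      ... | inj₂ later = later

  abstract
    component : Subset n → Fin n → Subset n
    component W u = Vec.tabulate (λ v → does (reach? W u v))

    ∈-component⁻ : ∀ {W u v} → v ∈ component W u → Reach G W u v
    ∈-component⁻ {W} {u} {v} v∈C =
      does⇒ (reach? W u v) (trans (sym (VecP.lookup∘tabulate _ v)) (∈⇒lookup≡true v∈C))
      where
      does⇒ : ∀ {P : Set} (d : Dec P) → does d ≡ true → P
      does⇒ (yes p) _  = p
      does⇒ (no _)  ()

    ∈-component⁺ : ∀ {W u v} → Reach G W u v → v ∈ component W u
    ∈-component⁺ {W} {u} {v} r =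
      lookup≡true⇒∈ (trans (VecP.lookup∘tabulate _ v) (dec-true (reach? W u v) r))

  ConnectedSet : Subset n → Set
  ConnectedSet S = ∀ {a b} → a ∈ S → b ∈ S → Reach G S a b

  module _ {W C : Subset n} (C-comp : IsComponent G W C) where

    IsComponent-reach : ∀ {a b} → a ∈ C → b ∈ C → Reach G W a b
    IsComponent-reach a∈C = Equivalence.to (proj₂ C-comp _ a∈C _)

    IsComponent-closed : ∀ {a b} → a ∈ C → Reach G W a b → b ∈ C
    IsComponent-closed a∈C = Equivalence.from (proj₂ C-comp _ a∈C _)

    IsComponent-⊆ : C ⊆ W
    IsComponent-⊆ a∈C = Reach-start (IsComponent-reach a∈C a∈C)

    IsComponent-adj : ∀ {a b} → a ∈ C → b ∈ W → T (adj G a b) → b ∈ C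
    IsComponent-adj a∈C b∈W e = IsComponent-closed a∈C (step (IsComponent-⊆ a∈C) e (here b∈W))

    IsComponent-≡-component : ∀ {u} → u ∈ C → C ≡ component W u
    IsComponent-≡-component u∈C = SP.⊆-antisym
      (∈-component⁺ ∘ IsComponent-reach u∈C) (IsComponent-closed u∈C ∘ ∈-component⁻)

    IsComponent-Reach : ∀ {a b} → a ∈ C → Reach G W a b → Reach G C a b
    IsComponent-Reach a∈C (here _)     = here a∈C
    IsComponent-Reach a∈C (step _ e r) =
      step a∈C e (IsComponent-Reach (IsComponent-adj a∈C (Reach-start r) e) r)

    IsComponent-connected : ConnectedSet C
    IsComponent-connected a∈C b∈C = IsComponent-Reach a∈C (IsComponent-reach a∈C b∈C)

    Reach-avoiding : ∀ {a b} → a ∉ C → Reach G W a b → Reach G (W ∖ C) a b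
    Reach-avoiding a∉C (here a∈W)             = here (∖⁺ a∈W a∉C)
    Reach-avoiding a∉C (step {_} {b} a∈W e r) = step (∖⁺ a∈W a∉C) e (Reach-avoiding b∉C r)
      where
      b∉C : b ∉ C
      b∉C b∈C = a∉C (IsComponent-adj b∈C a∈W (subst T (Graph.sym G _ _) e))

  IsComponent-unique : ∀ {W C D x} → IsComponent G W C → IsComponent G W D → x ∈ C → x ∈ D → C ≡ D
  IsComponent-unique C-comp D-comp x∈C x∈D =
    trans (IsComponent-≡-component C-comp x∈C) (sym (IsComponent-≡-component D-comp x∈D))

  component-IsComponent : ∀ {W u} → u ∈ W → IsComponent G W (component W u)
  component-IsComponent u∈W = (_ , ∈-component⁺ (here u∈W)) , λ a a∈C v → mk⇔
    (λ v∈C → Reach-trans (Reach-sym (∈-component⁻ a∈C)) (∈-component⁻ v∈C))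
    (λ r → ∈-component⁺ (Reach-trans (∈-component⁻ a∈C) r))

  ConnectedSet-IsComponent : ∀ {S s} → s ∈ S → ConnectedSet S → IsComponent G S S
  ConnectedSet-IsComponent s∈S S-conn = (_ , s∈S) , λ a a∈S v → mk⇔ (S-conn a∈S) Reach-end

  IsComponent-∖⁻ : ∀ {W C E} → IsComponent G W C → IsComponent G (W ∖ C) E → IsComponent G W E
  IsComponent-∖⁻ C-comp E-comp = proj₁ E-comp , λ a a∈E v → mk⇔
    (λ v∈E → Reach-mono ∖-⊆ (IsComponent-reach E-comp a∈E v∈E))
    (λ r → IsComponent-closed E-comp a∈E
             (Reach-avoiding C-comp (proj₂ (∖⁻ (IsComponent-⊆ E-comp a∈E))) r))

  IsComponent-∖⁺ : ∀ {W C D} → IsComponent G W C → IsComponent G W D → C ≢ D → IsComponent G (W ∖ C) D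
  IsComponent-∖⁺ {W} {C} {D} C-comp D-comp C≢D = proj₁ D-comp , λ a a∈D v → mk⇔
    (λ v∈D → Reach-avoiding C-comp (a∉C a∈D) (IsComponent-reach D-comp a∈D v∈D))
    (λ r → IsComponent-closed D-comp a∈D (Reach-mono ∖-⊆ r))
    where
    a∉C : ∀ {a} → a ∈ D → a ∉ C
    a∉C a∈D a∈C = C≢D (IsComponent-unique C-comp D-comp a∈C a∈D)

  Components-[] : ∀ {W} → Empty W → Components G W []
  Components-[] W=∅ =
    [] , (λ E E-comp → ⊥-elim (W=∅ (_ , IsComponent-⊆ E-comp (proj₂ (proj₁ E-comp))))) , []

  Components-∷ : ∀ {W C cs} → IsComponent G W C → Components G (W ∖ C) cs → Components G W (C ∷ cs)
  Components-∷ {W} {C} {cs} C-comp (cs-comp , complete , unique) =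
    (C-comp ∷ All.map (IsComponent-∖⁻ C-comp) cs-comp) , complete′ , (All.tabulate C≢cs ∷ unique)
    where
    C≢cs : ∀ {D} → D ∈ₗ cs → C ≢ D
    C≢cs D∈cs refl with All.lookup cs-comp D∈cs
    ... | (d , d∈C) , _ = proj₂ (∖⁻ (IsComponent-⊆ (All.lookup cs-comp D∈cs) d∈C)) d∈C
    complete′ : ∀ E → IsComponent G W E → E ∈ₗ C ∷ cs
    complete′ E E-comp with proj₁ E-comp
    ... | e , e∈E with e SP.∈? C
    ...   | yes e∈C = here (IsComponent-unique E-comp C-comp e∈E e∈C)
    ...   | no e∉C  = there (complete E (IsComponent-∖⁺ C-comp E-comp λ { refl → e∉C e∈E }))

  Components-∷⁻ : ∀ {W C cs} → Components G W (C ∷ cs) → Components G (W ∖ C) cs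
  Components-∷⁻ {W} {C} {cs} (C-comp ∷ cs-comp , complete , C≢cs ∷ unique) =
    All.tabulate (λ D∈cs → IsComponent-∖⁺ C-comp (All.lookup cs-comp D∈cs) (All.lookup C≢cs D∈cs)) ,
    complete′ , unique
    where
    complete′ : ∀ E → IsComponent G (W ∖ C) E → E ∈ₗ cs
    complete′ E E-comp with complete E (IsComponent-∖⁻ C-comp E-comp)
    ... | there E∈cs = E∈cs
    ... | here refl with proj₁ E-comp
    ...   | e , e∈E = ⊥-elim (proj₂ (∖⁻ (IsComponent-⊆ E-comp e∈E)) e∈E)

  ⋃-Components : ∀ {W cs} → Components G W cs → ⋃ cs ⊆ W
  ⋃-Components (cs-comp , _) = ⋃-⊆ (All.map IsComponent-⊆ cs-comp)

  Components-⋃ : ∀ {W cs} → Components G W cs → W ≡ ⋃ cs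
  Components-⋃ cs-comp@(_ , complete , _) = SP.⊆-antisym
    (λ x∈W → ∈-⋃⁺ (complete _ (component-IsComponent x∈W)) (∈-component⁺ (here x∈W)))
    (⋃-Components cs-comp)

  Components-disjoint : ∀ {W cs} → Components G W cs → AllPairs Disjoint cs
  Components-disjoint (cs-comp , _ , unique) = go cs-comp unique
    where
    go : ∀ {cs} → All (IsComponent G _) cs → AllPairs _≢_ cs → AllPairs Disjoint cs
    go []                  []                = []
    go (C-comp ∷ cs-comp) (C≢cs ∷ unique) =
      All.zipWith (λ (D-comp , C≢D) {_} x∈C x∈D → C≢D (IsComponent-unique C-comp D-comp x∈C x∈D))
                  (cs-comp , C≢cs)
      ∷ go cs-comp unique

  Components-↭ : ∀ {W cs ds} → Components G W cs → Components G W ds → cs ↭ ds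
  Components-↭ (cs-comp , cs-complete , cs-unique) (ds-comp , ds-complete , ds-unique) =
    ∼bag⇒↭ (unique∧set⇒bag cs-unique ds-unique (mk⇔
      (λ C∈cs → ds-complete _ (All.lookup cs-comp C∈cs))
      (λ C∈ds → cs-complete _ (All.lookup ds-comp C∈ds))))

  abstract
    components : ∀ W → Σ (List (Subset n)) (Components G W)
    components W = go W (⊂-wellFounded W)
      where
      go : ∀ W → Acc _⊂_ W → Σ (List (Subset n)) (Components G W)
      go W (acc rs) with SP.nonempty? W
      ... | no W=∅ = [] , Components-[] W=∅
      ... | yes (u , u∈W) with go (W ∖ component W u) (rs (∖-⊂ u∈W (∈-component⁺ (here u∈W))))
      ...   | cs , cs-comp = component W u ∷ cs , Components-∷ (component-IsComponent u∈W) cs-comp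

sumW-↭ : ∀ {n} {cs ds : List (Subset n)} → cs ↭ ds → sumW cs ≡ sumW ds
sumW-↭ {cs = cs} {ds} cs↭ds = begin
  sumW cs                                    ≡⟨ sumW≡foldr cs ⟩
  List.foldr _+_ 0ℚ (List.map (w ∘ ∣_∣) cs)  ≡⟨ PermutationₛP.foldr-commMonoid QP.+-0-isCommutativeMonoid
                                                  (↭⇒↭ₛ (PermutationP.map⁺ (w ∘ ∣_∣) cs↭ds)) ⟩
  List.foldr _+_ 0ℚ (List.map (w ∘ ∣_∣) ds)  ≡⟨ sumW≡foldr ds ⟨
  sumW ds                                    ∎
  where
  open ≡-Reasoning
  sumW≡foldr : ∀ cs → sumW cs ≡ List.foldr _+_ 0ℚ (List.map (w ∘ ∣_∣) cs)
  sumW≡foldr []       = refl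
  sumW≡foldr (C ∷ cs) = cong (w ∣ C ∣ +_) (sumW≡foldr cs)

module _ {n : ℕ} (G : Graph n) where

  componentSum : Subset n → ℚ
  componentSum W = sumW (proj₁ (components G W))

  sumW-Components : ∀ {W cs} → Components G W cs → sumW cs ≡ componentSum W
  sumW-Components cs-comp = sumW-↭ (Components-↭ G cs-comp (proj₂ (components G _)))

  componentSum-peel : ∀ {W C} → IsComponent G W C → componentSum W ≡ w ∣ C ∣ + componentSum (W ∖ C)
  componentSum-peel C-comp = sym (sumW-Components (Components-∷ G C-comp (proj₂ (components G _))))

  componentSum-empty : ∀ {W} → Empty W → componentSum W ≡ 0ℚ
  componentSum-empty W=∅ = sym (sumW-Components (Components-[] G W=∅))

  componentSum-connected : ∀ {S s} → s ∈ S → ConnectedSet G S → componentSum S ≡ w ∣ S ∣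
  componentSum-connected {S} s∈S S-conn = trans (sym (sumW-Components S-components)) (QP.+-identityʳ _)
    where
    S-components : Components G S (S ∷ [])
    S-components = Components-∷ G (ConnectedSet-IsComponent G s∈S S-conn)
                     (Components-[] G λ (_ , x∈S∖S) → proj₂ (∖⁻ x∈S∖S) (proj₁ (∖⁻ x∈S∖S)))

  componentSum-nonneg : ∀ W → 0ℚ ≤ℚ componentSum W
  componentSum-nonneg W =
    subst (0ℚ ≤ℚ_) (sym (sumW≡∑ (proj₁ (components G W)))) (∑-nonneg (proj₁ (components G W)) (w-nonneg ∘ ∣_∣))

  componentSum≤w∣∣ : ∀ W → componentSum W ≤ℚ w ∣ W ∣
  componentSum≤w∣∣ W = go W (⊂-wellFounded W)
    where
    go : ∀ W → Acc _⊂_ W → componentSum W ≤ℚ w ∣ W ∣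
    go W (acc rs) with SP.nonempty? W
    ... | no W=∅ = QP.≤-trans (QP.≤-reflexive (componentSum-empty W=∅)) (w-nonneg ∣ W ∣)
    ... | yes (u , u∈W) = begin
      componentSum W                     ≡⟨ componentSum-peel C-comp ⟩
      w ∣ C ∣ + componentSum (W ∖ C)     ≤⟨ QP.+-monoʳ-≤ (w ∣ C ∣) (go (W ∖ C) (rs (∖-⊂ u∈W u∈C))) ⟩
      w ∣ C ∣ + w ∣ W ∖ C ∣               ≤⟨ w-superadditive ∣ C ∣ ∣ W ∖ C ∣ ⟩
      w (∣ C ∣ ℕ.+ ∣ W ∖ C ∣)             ≡⟨ cong w (∣p∣≡∣q∣+∣p∖q∣ (IsComponent-⊆ G C-comp)) ⟨
      w ∣ W ∣                            ∎
      where
      open QP.≤-Reasoning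
      C = component G W u
      C-comp = component-IsComponent G u∈W
      u∈C = ∈-component⁺ G (here u∈W)

  Separated : Subset n → Subset n → Set
  Separated Z₁ Z₂ = Disjoint Z₁ Z₂ × (∀ {a b} → a ∈ Z₁ → b ∈ Z₂ → ¬ T (adj G a b))

  module _ {Z₁ Z₂ : Subset n} (sep : Separated Z₁ Z₂) where

    Reach-separated : ∀ {a b} → a ∈ Z₁ → Reach G (Z₁ ∪ Z₂) a b → Reach G Z₁ a b
    Reach-separated a∈Z₁ (here _)     = here a∈Z₁
    Reach-separated a∈Z₁ (step _ e r) with ∪⁻ (Reach-start G r)
    ... | inj₁ b∈Z₁ = step a∈Z₁ e (Reach-separated b∈Z₁ r)
    ... | inj₂ b∈Z₂ = ⊥-elim (proj₂ sep a∈Z₁ b∈Z₂ e)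

    IsComponent-separated : ∀ {D} → IsComponent G Z₁ D → IsComponent G (Z₁ ∪ Z₂) D
    IsComponent-separated D-comp = proj₁ D-comp , λ a a∈D v → mk⇔
      (λ v∈D → Reach-mono G ∪⁺ˡ (IsComponent-reach G D-comp a∈D v∈D))
      (λ r → IsComponent-closed G D-comp a∈D (Reach-separated (IsComponent-⊆ G D-comp a∈D) r))

  componentSum-∪ : ∀ {Z₁ Z₂} → Separated Z₁ Z₂ → componentSum (Z₁ ∪ Z₂) ≡ componentSum Z₁ + componentSum Z₂
  componentSum-∪ {Z₁} {Z₂} = go Z₁ (⊂-wellFounded Z₁)
    where
    open ≡-Reasoning
    go : ∀ Z₁ → Acc _⊂_ Z₁ → Separated Z₁ Z₂ → componentSum (Z₁ ∪ Z₂) ≡ componentSum Z₁ + componentSum Z₂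
    go Z₁ (acc rs) sep with SP.nonempty? Z₁
    ... | no Z₁=∅ = begin
      componentSum (Z₁ ∪ Z₂)            ≡⟨ cong (λ Z → componentSum (Z ∪ Z₂)) (SP.Empty-unique Z₁=∅) ⟩
      componentSum (⊥ ∪ Z₂)             ≡⟨ cong componentSum (SP.∪-identityˡ Z₂) ⟩
      componentSum Z₂                   ≡⟨ QP.+-identityˡ _ ⟨
      0ℚ + componentSum Z₂              ≡⟨ cong (_+ componentSum Z₂) (componentSum-empty Z₁=∅) ⟨
      componentSum Z₁ + componentSum Z₂ ∎
    ... | yes (u , u∈Z₁) = begin
      componentSum (Z₁ ∪ Z₂)
        ≡⟨ componentSum-peel (IsComponent-separated sep D-comp) ⟩
      w ∣ D ∣ + componentSum ((Z₁ ∪ Z₂) ∖ D)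
        ≡⟨ cong (λ Z → w ∣ D ∣ + componentSum Z) Z₁∪Z₂∖D ⟩
      w ∣ D ∣ + componentSum ((Z₁ ∖ D) ∪ Z₂)
        ≡⟨ cong (w ∣ D ∣ +_) (go (Z₁ ∖ D) (rs (∖-⊂ u∈Z₁ u∈D)) sep′) ⟩
      w ∣ D ∣ + (componentSum (Z₁ ∖ D) + componentSum Z₂)
        ≡⟨ QP.+-assoc (w ∣ D ∣) _ _ ⟨
      w ∣ D ∣ + componentSum (Z₁ ∖ D) + componentSum Z₂
        ≡⟨ cong (_+ componentSum Z₂) (componentSum-peel D-comp) ⟨
      componentSum Z₁ + componentSum Z₂ ∎
      where
      D = component G Z₁ u
      D-comp = component-IsComponent G u∈Z₁
      u∈D = ∈-component⁺ G (here u∈Z₁)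
      sep′ : Separated (Z₁ ∖ D) Z₂
      sep′ = proj₁ sep ∘ ∖-⊆ , proj₂ sep ∘ ∖-⊆
      Z₁∪Z₂∖D : (Z₁ ∪ Z₂) ∖ D ≡ (Z₁ ∖ D) ∪ Z₂
      Z₁∪Z₂∖D = SP.⊆-antisym
        (λ m → [ (λ x∈Z₁ → ∪⁺ˡ (∖⁺ x∈Z₁ (proj₂ (∖⁻ m)))) , ∪⁺ʳ ]′ (∪⁻ (∖-⊆ m)))
        (λ m → [ (λ x∈Z₁∖D → ∖⁺ (∪⁺ˡ (∖-⊆ x∈Z₁∖D)) (proj₂ (∖⁻ x∈Z₁∖D)))
               , (λ x∈Z₂ → ∖⁺ (∪⁺ʳ x∈Z₂) (λ x∈D → proj₁ sep (IsComponent-⊆ G D-comp x∈D) x∈Z₂)) ]′ (∪⁻ m))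

  componentSum-split : ∀ {W C Z} → IsComponent G W C → Z ⊆ W →
                       componentSum Z ≡ componentSum (Z ∩ C) + componentSum (Z ∖ C)
  componentSum-split {W} {C} {Z} C-comp Z⊆W = trans (cong componentSum Z≡) (componentSum-∪ sep)
    where
    Z≡ : Z ≡ (Z ∩ C) ∪ (Z ∖ C)
    Z≡ = sym (begin
      (Z ∩ C) ∪ (Z ∖ C)  ≡⟨ SP.∩-distribˡ-∪ Z C (∁ C) ⟨
      Z ∩ (C ∪ ∁ C)      ≡⟨ cong (Z ∩_) (SP.p∪∁p≡⊤ C) ⟩
      Z ∩ ⊤              ≡⟨ SP.∩-identityʳ Z ⟩
      Z                  ∎)
      where open ≡-Reasoning
    sep : Separated (Z ∩ C) (Z ∖ C)
    sep = (λ a∈Z∩C a∈Z∖C → proj₂ (∖⁻ a∈Z∖C) (proj₂ (∩⁻ a∈Z∩C)))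
        , (λ a∈Z∩C b∈Z∖C e → proj₂ (∖⁻ b∈Z∖C)
              (IsComponent-adj G C-comp (proj₂ (∩⁻ a∈Z∩C)) (Z⊆W (∖-⊆ b∈Z∖C)) e))

  componentSum-∖ : ∀ {W cs} → Components G W cs → ∀ X →
                   componentSum (W ∖ X) ≡ ∑ cs (λ C → componentSum (C ∖ X))
  componentSum-∖ {W} {[]} (_ , complete , _) X = componentSum-empty W∖X=∅
    where
    W∖X=∅ : Empty (W ∖ X)
    W∖X=∅ (_ , x∈W∖X) with complete _ (component-IsComponent G (∖-⊆ x∈W∖X))
    ... | ()
  componentSum-∖ {W} {C ∷ cs} cs-comp@(C-comp ∷ _ , _ , _) X = begin
    componentSum (W ∖ X)
      ≡⟨ componentSum-split C-comp ∖-⊆ ⟩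
    componentSum ((W ∖ X) ∩ C) + componentSum ((W ∖ X) ∖ C)
      ≡⟨ cong₂ (λ P Q → componentSum P + componentSum Q) W∖X∩C ∖-swap ⟩
    componentSum (C ∖ X) + componentSum ((W ∖ C) ∖ X)
      ≡⟨ cong (componentSum (C ∖ X) +_) (componentSum-∖ (Components-∷⁻ G cs-comp) X) ⟩
    componentSum (C ∖ X) + ∑ cs (λ D → componentSum (D ∖ X)) ∎
    where
    open ≡-Reasoning
    W∖X∩C : (W ∖ X) ∩ C ≡ C ∖ X
    W∖X∩C = SP.⊆-antisym
      (λ m → ∖⁺ (proj₂ (∩⁻ m)) (proj₂ (∖⁻ (proj₁ (∩⁻ m)))))
      (λ m → ∩⁺ (∖⁺ (IsComponent-⊆ G C-comp (∖-⊆ m)) (proj₂ (∖⁻ m))) (∖-⊆ m))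
    ∖-swap : (W ∖ X) ∖ C ≡ (W ∖ C) ∖ X
    ∖-swap = trans (SP.∩-assoc W (∁ X) (∁ C))
               (trans (cong (W ∩_) (SP.∩-comm (∁ X) (∁ C))) (sym (SP.∩-assoc W (∁ C) (∁ X))))

-- The vectors x^T

module _ {n : ℕ} (G : Graph n) where

  mutual
    xT-outside : ∀ {S} (t : ElimTree G S) {u} → u ∉ S → xT G t u ≡ 0ℚ
    xT-outside (node v v∈S cs cs-comp ts) {u} u∉S with u ≟ v
    ... | yes refl = ⊥-elim (u∉S v∈S)
    ... | no _     = xTs-outside ts (u∉S ∘ ∖-⊆ ∘ ⋃-Components G cs-comp)

    xTs-outside : ∀ {cs} (ts : All (ElimTree G) cs) → ∀ {u} → u ∉ ⋃ cs → xTs G ts u ≡ 0ℚ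
    xTs-outside []       u∉⋃cs = refl
    xTs-outside (t ∷ ts) u∉⋃cs = trans
      (cong₂ _+_ (xT-outside t (u∉⋃cs ∘ ∪⁺ˡ)) (xTs-outside ts (u∉⋃cs ∘ ∪⁺ʳ)))
      (QP.+-identityʳ 0ℚ)

  module _ {S : Subset n} {v : Fin n} (v∈S : v ∈ S) {cs : List (Subset n)} (cs-comp : Components G (S ∖ ⁅ v ⁆) cs)
           (ts : All (ElimTree G) cs) where

    xT-node : ∀ u → xT G (node v v∈S cs cs-comp ts) u ≡ δ v (w ∣ S ∣ - sumW cs) u + xTs G ts u
    xT-node u with u ≟ v
    ... | yes refl = sym (trans (cong (w ∣ S ∣ - sumW cs +_) (xTs-outside ts v∉⋃cs)) (QP.+-identityʳ _))
      where
      v∉⋃cs : v ∉ ⋃ cs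
      v∉⋃cs v∈⋃cs = proj₂ (∖⁻ (⋃-Components G cs-comp v∈⋃cs)) (SP.x∈⁅x⁆ v)
    ... | no _ = sym (QP.+-identityˡ _)

    ⟨⟩-xT-node : ∀ X → (xT G (node v v∈S cs cs-comp ts)) ⟨ X ⟩ ≡ (δ v (w ∣ S ∣ - sumW cs)) ⟨ X ⟩ + (xTs G ts) ⟨ X ⟩
    ⟨⟩-xT-node X = trans (⟨⟩-cong X (λ {u} _ → xT-node u)) (⟨⟩-+ _ (xTs G ts) X)

  mutual
    xT-total : ∀ {S} (t : ElimTree G S) → (xT G t) ⟨ ⊤ ⟩ ≡ w ∣ S ∣
    xT-total {S} (node v v∈S cs cs-comp ts) = begin
      ((xT G (node v v∈S cs cs-comp ts)) ⟨ ⊤ ⟩)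
        ≡⟨ ⟨⟩-xT-node v∈S cs-comp ts ⊤ ⟩
      ((δ v (w ∣ S ∣ - sumW cs)) ⟨ ⊤ ⟩ + (xTs G ts) ⟨ ⊤ ⟩)
        ≡⟨ cong₂ _+_ (⟨⟩-δ-∈ {v = v} {X = ⊤} (w ∣ S ∣ - sumW cs) SP.∈⊤) (xTs-total ts) ⟩
      ((w ∣ S ∣ - sumW cs) + sumW cs)
        ≡⟨ solve 2 (λ a b → (a :- b) :+ b := a) refl (w ∣ S ∣) (sumW cs) ⟩
      w ∣ S ∣ ∎
      where open ≡-Reasoning

    xTs-total : ∀ {cs} (ts : All (ElimTree G) cs) → (xTs G ts) ⟨ ⊤ ⟩ ≡ sumW cs
    xTs-total []       = ⟨⟩-≡0 {x = xTs G []} ⊤ λ _ → refl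
    xTs-total (t ∷ ts) = trans (⟨⟩-+ (xT G t) (xTs G ts) ⊤) (cong₂ _+_ (xT-total t) (xTs-total ts))

  fOn : Subset n → Subset n → ℚ
  fOn S Y = w ∣ S ∣ - componentSum G (S ∖ Y)

  module _ {S : Subset n} {v : Fin n} (v∈S : v ∈ S) {cs : List (Subset n)} (cs-comp : Components G (S ∖ ⁅ v ⁆) cs)
           (ts : All (ElimTree G) cs) {X : Subset n}
           (children-bound : (xTs G ts) ⟨ X ⟩ ≤ℚ ∑ cs (λ C → fOn C X)) where

    private
      t = node v v∈S cs cs-comp ts
      r = w ∣ S ∣ - sumW cs
      open QP.≤-Reasoning

    xT-bound-root∈ : v ∈ X → (xT G t) ⟨ X ⟩ ≤ℚ fOn S X
    xT-bound-root∈ v∈X = begin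
      ((xT G t) ⟨ X ⟩)
        ≡⟨ ⟨⟩-xT-node v∈S cs-comp ts X ⟩
      ((δ v r) ⟨ X ⟩ + (xTs G ts) ⟨ X ⟩)
        ≡⟨ cong (_+ ((xTs G ts) ⟨ X ⟩)) (⟨⟩-δ-∈ r v∈X) ⟩
      (r + (xTs G ts) ⟨ X ⟩)
        ≤⟨ QP.+-monoʳ-≤ r children-bound ⟩
      (r + ∑ cs (λ C → fOn C X))
        ≡⟨ cong (r +_) (∑-− cs (w ∘ ∣_∣) cut) ⟩
      (r + (∑ cs (w ∘ ∣_∣) - ∑ cs cut))
        ≡⟨ cong (λ s → r + (s - ∑ cs cut)) (sumW≡∑ cs) ⟨
      (r + (sumW cs - ∑ cs cut))
        ≡⟨ solve 3 (λ a b c → (a :- b) :+ (b :- c) := a :- c) refl (w ∣ S ∣) (sumW cs) (∑ cs cut) ⟩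
      (w ∣ S ∣ - ∑ cs cut)
        ≡⟨ cong (λ q → w ∣ S ∣ - q) (componentSum-∖ G cs-comp X) ⟨
      (w ∣ S ∣ - componentSum G ((S ∖ ⁅ v ⁆) ∖ X))
        ≡⟨ cong (λ Z → w ∣ S ∣ - componentSum G Z) S∖v∖X≡S∖X ⟩
      fOn S X ∎
      where
      cut : Subset n → ℚ
      cut C = componentSum G (C ∖ X)
      S∖v∖X≡S∖X : (S ∖ ⁅ v ⁆) ∖ X ≡ S ∖ X
      S∖v∖X≡S∖X = SP.⊆-antisym
        (λ m → ∖⁺ (∖-⊆ (∖-⊆ m)) (proj₂ (∖⁻ m)))
        (λ m → ∖⁺ (∖⁺ (∖-⊆ m) (proj₂ (∖⁻ m) ∘ ⁅⁆-⊆ v∈X)) (proj₂ (∖⁻ m)))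

    xT-bound-disjoint : ConnectedSet G S → Disjoint X S → (xT G t) ⟨ X ⟩ ≤ℚ fOn S X
    xT-bound-disjoint S-conn X#S = QP.≤-reflexive (begin-equality
      ((xT G t) ⟨ X ⟩)              ≡⟨ ⟨⟩-≡0 X (xT-outside t ∘ X#S) ⟩
      0ℚ                            ≡⟨ QP.+-inverseʳ (w ∣ S ∣) ⟨
      (w ∣ S ∣ - (w ∣ S ∣))         ≡⟨ cong (λ q → w ∣ S ∣ - q) (componentSum-connected G v∈S S-conn) ⟨
      (w ∣ S ∣ - componentSum G S)   ≡⟨ cong (λ Z → w ∣ S ∣ - componentSum G Z) S≡S∖X ⟩
      fOn S X                       ∎)
      where
      S≡S∖X : S ≡ S ∖ X
      S≡S∖X = SP.⊆-antisym (λ x∈S → ∖⁺ x∈S λ x∈X → X#S x∈X x∈S) ∖-⊆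

    -- As a ∈ S ∩ X, f_S(X) ≥ 3^(|S|-2) - 3^(|S|-3) ≥ 3^(|S|-3), while the children contribute
    -- at most Σ_C 3^(|C|-2) ≤ 3^(|S|-3).
    xT-bound-root∉ : v ∉ X → ∀ {a} → a ∈ X → a ∈ S → (xT G t) ⟨ X ⟩ ≤ℚ fOn S X
    xT-bound-root∉ v∉X {a} a∈X a∈S = begin
      ((xT G t) ⟨ X ⟩)
        ≡⟨ ⟨⟩-xT-node v∈S cs-comp ts X ⟩
      ((δ v r) ⟨ X ⟩ + (xTs G ts) ⟨ X ⟩)
        ≡⟨ cong (_+ (xTs G ts) ⟨ X ⟩) (⟨⟩-δ-∉ r v∉X) ⟩
      (0ℚ + (xTs G ts) ⟨ X ⟩)
        ≡⟨ QP.+-identityˡ _ ⟩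
      ((xTs G ts) ⟨ X ⟩)
        ≤⟨ children-bound ⟩
      ∑ cs (λ C → fOn C X)
        ≤⟨ ∑-mono-≤ (All.universal (λ C → p-q≤p (w ∣ C ∣) (componentSum-nonneg G (C ∖ X))) cs) ⟩
      (∑ cs (w ∘ ∣_∣))
        ≡⟨ sumW≡∑ cs ⟨
      sumW cs
        ≡⟨ sumW-Components G cs-comp ⟩
      (componentSum G (S ∖ ⁅ v ⁆))
        ≤⟨ componentSum≤w∣∣ G (S ∖ ⁅ v ⁆) ⟩
      w m
        ≤⟨ p+q≤r⇒p≤r-q (w-double m) ⟩
      (w (suc m) - w m)
        ≤⟨ p-q≤p-r (w (suc m)) (QP.≤-trans (componentSum≤w∣∣ G (S ∖ X)) (w-mono-≤ ∣S∖X∣≤m)) ⟩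
      (w (suc m) - componentSum G (S ∖ X))
        ≡⟨ cong (λ k → w k - componentSum G (S ∖ X)) (∣p∣≡1+∣p∖⁅x⁆∣ v∈S) ⟨
      fOn S X ∎
      where
      m = ∣ S ∖ ⁅ v ⁆ ∣
      ∣S∖X∣≤m : ∣ S ∖ X ∣ ≤ m
      ∣S∖X∣≤m = ℕP.≤-pred (subst (∣ S ∖ X ∣ ℕ.<_) (∣p∣≡1+∣p∖⁅x⁆∣ v∈S) (SP.p⊂q⇒∣p∣<∣q∣ (∖-⊂ a∈S a∈X)))

  mutual
    xT-bound : ∀ {S} (t : ElimTree G S) → ConnectedSet G S → ∀ X → (xT G t) ⟨ X ⟩ ≤ℚ fOn S X
    xT-bound {S} (node v v∈S cs cs-comp ts) S-conn X = by-cases (v SP.∈? X) (SP.nonempty? (X ∩ S))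
      where
      children-bound = xTs-bound ts (proj₁ cs-comp) X
      by-cases : Dec (v ∈ X) → Dec (∃ λ a → a ∈ X ∩ S) → (xT G (node v v∈S cs cs-comp ts)) ⟨ X ⟩ ≤ℚ fOn S X
      by-cases (yes v∈X) _                  = xT-bound-root∈ v∈S cs-comp ts children-bound v∈X
      by-cases (no v∉X)  (yes (a , a∈X∩S)) =
        xT-bound-root∉ v∈S cs-comp ts children-bound v∉X (proj₁ (∩⁻ a∈X∩S)) (proj₂ (∩⁻ a∈X∩S))
      by-cases (no v∉X)  (no X∩S=∅)        =
        xT-bound-disjoint v∈S cs-comp ts children-bound S-conn (λ u∈X u∈S → X∩S=∅ (_ , ∩⁺ u∈X u∈S))

    xTs-bound : ∀ {W cs} (ts : All (ElimTree G) cs) → All (IsComponent G W) cs →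
                ∀ X → (xTs G ts) ⟨ X ⟩ ≤ℚ ∑ cs (λ C → fOn C X)
    xTs-bound []       []                  X = QP.≤-reflexive (⟨⟩-≡0 {x = xTs G []} X λ _ → refl)
    xTs-bound (t ∷ ts) (C-comp ∷ cs-comp) X = QP.≤-trans (QP.≤-reflexive (⟨⟩-+ (xT G t) (xTs G ts) X))
      (QP.+-mono-≤ (xT-bound t (IsComponent-connected G C-comp) X) (xTs-bound ts cs-comp X))

-- Greedy vectors

module _ {n : ℕ} where

  contract : (Subset n → ℚ) → Subset n → Subset n → ℚ
  contract g A Y = g (Y ∪ A) - g A

  contract-contract : ∀ g (A B Y : Subset n) → contract (contract g A) B Y ≡ contract g (B ∪ A) Y
  contract-contract g A B Y = begin
    (g ((Y ∪ B) ∪ A) - g A) - (g (B ∪ A) - g A)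
      ≡⟨ solve 3 (λ p q r → (p :- r) :- (q :- r) := p :- q) refl (g ((Y ∪ B) ∪ A)) (g (B ∪ A)) (g A) ⟩
    g ((Y ∪ B) ∪ A) - g (B ∪ A)
      ≡⟨ cong (λ Z → g Z - g (B ∪ A)) (SP.∪-assoc Y B A) ⟩
    g (Y ∪ (B ∪ A)) - g (B ∪ A) ∎
    where open ≡-Reasoning

  piecewise : Subset n → (Fin n → ℚ) → (Fin n → ℚ) → Fin n → ℚ
  piecewise A y z u = if lookup A u then y u else z u

  piecewise-∈ : ∀ {A u} y z → u ∈ A → piecewise A y z u ≡ y u
  piecewise-∈ y z u∈A = cong (λ b → if b then _ else _) (∈⇒lookup≡true u∈A)

  piecewise-∉ : ∀ {A u} y z → u ∉ A → piecewise A y z u ≡ z u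
  piecewise-∉ y z u∉A = cong (λ b → if b then _ else _) (∉⇒lookup≡false u∉A)

  DependsOnlyOn : Subset n → (Subset n → ℚ) → Set
  DependsOnlyOn A f = ∀ Y Y′ → Y ∩ A ≡ Y′ ∩ A → f Y ≡ f Y′

  DependsOnlyOn-⊆ : ∀ {A B : Subset n} {f} → A ⊆ B → DependsOnlyOn A f → DependsOnlyOn B f
  DependsOnlyOn-⊆ {A} {B} A⊆B f-local Y Y′ eq = f-local Y Y′ (begin
    Y ∩ A         ≡⟨ cong (Y ∩_) (⊆⇒∩≡ A⊆B) ⟨
    Y ∩ (B ∩ A)   ≡⟨ SP.∩-assoc Y B A ⟨
    (Y ∩ B) ∩ A   ≡⟨ cong (_∩ A) eq ⟩
    (Y′ ∩ B) ∩ A  ≡⟨ SP.∩-assoc Y′ B A ⟩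
    Y′ ∩ (B ∩ A)  ≡⟨ cong (Y′ ∩_) (⊆⇒∩≡ A⊆B) ⟩
    Y′ ∩ A        ∎)
    where open ≡-Reasoning

  DependsOnlyOn-∑ : ∀ cs {f : Subset n → Subset n → ℚ} → All (λ C → DependsOnlyOn C (f C)) cs →
                    DependsOnlyOn (⋃ cs) (λ Y → ∑ cs (λ C → f C Y))
  DependsOnlyOn-∑ []       []                  Y Y′ eq = refl
  DependsOnlyOn-∑ (C ∷ cs) (fC-local ∷ fcs-local) Y Y′ eq = cong₂ _+_
    (DependsOnlyOn-⊆ ∪⁺ˡ fC-local Y Y′ eq)
    (DependsOnlyOn-⊆ (∪⁺ʳ {p = C}) (DependsOnlyOn-∑ cs fcs-local) Y Y′ eq)

  DependsOnlyOn-∪⁅⁆ : ∀ {B : Subset n} {g v} → v ∉ B → DependsOnlyOn B g → ∀ Y → g (Y ∪ ⁅ v ⁆) ≡ g Y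
  DependsOnlyOn-∪⁅⁆ {B} {g} {v} v∉B g-local Y = g-local _ _ (SP.⊆-antisym
    (λ m → ∩⁺ ([ id , (λ x∈⁅v⁆ → ⊥-elim (v∉B (subst (_∈ B) (SP.x∈⁅y⁆⇒x≡y v x∈⁅v⁆) (proj₂ (∩⁻ m))))) ]′
                 (∪⁻ (proj₁ (∩⁻ m))))
              (proj₂ (∩⁻ m)))
    (λ m → ∩⁺ (∪⁺ˡ (proj₁ (∩⁻ m))) (proj₂ (∩⁻ m))))

  DependsOnlyOn-contract : ∀ {A : Subset n} {g v} → v ∈ A → DependsOnlyOn A g →
                           DependsOnlyOn (A ∖ ⁅ v ⁆) (contract g ⁅ v ⁆)
  DependsOnlyOn-contract {A} {g} {v} v∈A g-local Y Y′ eq = cong (_- g ⁅ v ⁆) (g-local _ _ (begin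
    (Y ∪ ⁅ v ⁆) ∩ A                 ≡⟨ Y∪v∩A Y ⟩
    (Y ∩ (A ∖ ⁅ v ⁆)) ∪ ⁅ v ⁆        ≡⟨ cong (_∪ ⁅ v ⁆) eq ⟩
    (Y′ ∩ (A ∖ ⁅ v ⁆)) ∪ ⁅ v ⁆       ≡⟨ Y∪v∩A Y′ ⟨
    (Y′ ∪ ⁅ v ⁆) ∩ A                ∎))
    where
    open ≡-Reasoning
    Y∪v∩A : ∀ Y → (Y ∪ ⁅ v ⁆) ∩ A ≡ (Y ∩ (A ∖ ⁅ v ⁆)) ∪ ⁅ v ⁆
    Y∪v∩A Y = SP.⊆-antisym to from
      where
      to : (Y ∪ ⁅ v ⁆) ∩ A ⊆ (Y ∩ (A ∖ ⁅ v ⁆)) ∪ ⁅ v ⁆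
      to {x} m with x ≟ v
      ... | yes refl = ∪⁺ʳ (SP.x∈⁅x⁆ v)
      ... | no x≢v   = ∪⁺ˡ (∩⁺ ([ id , (λ x∈⁅v⁆ → ⊥-elim (x≢v (SP.x∈⁅y⁆⇒x≡y v x∈⁅v⁆))) ]′ (∪⁻ (proj₁ (∩⁻ m))))
                                 (∖⁺ (proj₂ (∩⁻ m)) (SP.x≢y⇒x∉⁅y⁆ x≢v)))
      from : (Y ∩ (A ∖ ⁅ v ⁆)) ∪ ⁅ v ⁆ ⊆ (Y ∪ ⁅ v ⁆) ∩ A
      from m = [ (λ x∈Y∩A∖v → ∩⁺ (∪⁺ˡ (proj₁ (∩⁻ x∈Y∩A∖v))) (∖-⊆ (proj₂ (∩⁻ x∈Y∩A∖v))))
               , (λ x∈⁅v⁆ → ∩⁺ (∪⁺ʳ x∈⁅v⁆) (⁅⁆-⊆ v∈A x∈⁅v⁆)) ]′ (∪⁻ m)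

-- y is the vector produced by the greedy algorithm for g along some ordering of U.
data Greedy {n : ℕ} : Subset n → (Subset n → ℚ) → (Fin n → ℚ) → Set where
  done : ∀ {U g y} → Empty U → Greedy U g y
  pick : ∀ {U g y} v → v ∈ U → y v ≡ g ⁅ v ⁆ - g ⊥ →
         Greedy (U ∖ ⁅ v ⁆) (contract g ⁅ v ⁆) y → Greedy U g y

module _ {n : ℕ} where

  Greedy-cong : ∀ {U : Subset n} {g g′ y y′} c → Greedy U g y →
                (∀ {Y} → Y ⊆ U → g Y ≡ g′ Y + c) → (∀ {u} → u ∈ U → y u ≡ y′ u) → Greedy U g′ y′
  Greedy-cong c (done U=∅) _ _ = done U=∅
  Greedy-cong {U} {g} {g′} {y} {y′} c (pick v v∈U yv rest) g≗g′+c y≗y′ =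
    pick v v∈U y′v (Greedy-cong 0ℚ rest contract≗ (y≗y′ ∘ ∖-⊆))
    where
    open ≡-Reasoning
    cancel : ∀ a b → (a + c) - (b + c) ≡ a - b
    cancel a b = solve 3 (λ a b c → (a :+ c) :- (b :+ c) := a :- b) refl a b c
    y′v : y′ v ≡ g′ ⁅ v ⁆ - g′ ⊥
    y′v = begin
      y′ v                             ≡⟨ y≗y′ v∈U ⟨
      y v                              ≡⟨ yv ⟩
      g ⁅ v ⁆ - g ⊥                    ≡⟨ cong₂ _-_ (g≗g′+c (⁅⁆-⊆ v∈U)) (g≗g′+c SP.⊥⊆) ⟩
      (g′ ⁅ v ⁆ + c) - (g′ ⊥ + c)      ≡⟨ cancel (g′ ⁅ v ⁆) (g′ ⊥) ⟩
      g′ ⁅ v ⁆ - g′ ⊥                  ∎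
    contract≗ : ∀ {Y} → Y ⊆ U ∖ ⁅ v ⁆ → contract g ⁅ v ⁆ Y ≡ contract g′ ⁅ v ⁆ Y + 0ℚ
    contract≗ {Y} Y⊆U∖v = begin
      g (Y ∪ ⁅ v ⁆) - g ⁅ v ⁆                  ≡⟨ cong₂ _-_ (g≗g′+c Y∪v⊆U) (g≗g′+c (⁅⁆-⊆ v∈U)) ⟩
      (g′ (Y ∪ ⁅ v ⁆) + c) - (g′ ⁅ v ⁆ + c)    ≡⟨ cancel (g′ (Y ∪ ⁅ v ⁆)) (g′ ⁅ v ⁆) ⟩
      contract g′ ⁅ v ⁆ Y                      ≡⟨ QP.+-identityʳ _ ⟨
      contract g′ ⁅ v ⁆ Y + 0ℚ                 ∎
      where
      Y∪v⊆U : Y ∪ ⁅ v ⁆ ⊆ U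
      Y∪v⊆U m = [ ∖-⊆ ∘ Y⊆U∖v , ⁅⁆-⊆ v∈U ]′ (∪⁻ m)

  Greedy-cong₀ : ∀ {U : Subset n} {g g′ y y′} → Greedy U g y →
                 (∀ {Y} → Y ⊆ U → g Y ≡ g′ Y) → (∀ {u} → u ∈ U → y u ≡ y′ u) → Greedy U g′ y′
  Greedy-cong₀ gr g≗g′ = Greedy-cong 0ℚ gr (λ Y⊆U → trans (g≗g′ Y⊆U) (sym (QP.+-identityʳ _)))

  Greedy-glue : ∀ {A U : Subset n} {g y z} → A ⊆ U → Greedy A g y → Greedy (U ∖ A) (contract g A) z →
                Greedy U g (piecewise A y z)
  Greedy-glue {A} {U} {g} {y} {z} A⊆U (done A=∅) gz with SP.Empty-unique A=∅
  ... | refl = Greedy-cong (- g ⊥) (subst (λ V → Greedy V (contract g ⊥) z) (p∖⊥≡p U) gz)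
                 (λ {Y} _ → cong (λ Z → g Z - g ⊥) (SP.∪-identityʳ Y)) (λ _ → sym (piecewise-∉ y z SP.∉⊥))
  Greedy-glue {A} {U} {g} {y} {z} A⊆U (pick v v∈A yv gy) gz =
    pick v (A⊆U v∈A) (trans (piecewise-∈ y z v∈A) yv)
      (Greedy-cong₀ (Greedy-glue A∖v⊆U∖v gy gz′) (λ _ → refl) piecewise-agrees)
    where
    A∖v⊆U∖v : A ∖ ⁅ v ⁆ ⊆ U ∖ ⁅ v ⁆
    A∖v⊆U∖v m = ∖⁺ (A⊆U (∖-⊆ m)) (proj₂ (∖⁻ m))
    U∖v∖A∖v≡U∖A : (U ∖ ⁅ v ⁆) ∖ (A ∖ ⁅ v ⁆) ≡ U ∖ A
    U∖v∖A∖v≡U∖A = SP.⊆-antisym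
      (λ m → ∖⁺ (∖-⊆ (∖-⊆ m)) λ u∈A → proj₂ (∖⁻ m) (∖⁺ u∈A (proj₂ (∖⁻ (∖-⊆ m)))))
      (λ m → ∖⁺ (∖⁺ (∖-⊆ m) (λ u∈⁅v⁆ → proj₂ (∖⁻ m) (⁅⁆-⊆ v∈A u∈⁅v⁆))) (proj₂ (∖⁻ m) ∘ ∖-⊆))
    gz′ : Greedy ((U ∖ ⁅ v ⁆) ∖ (A ∖ ⁅ v ⁆)) (contract (contract g ⁅ v ⁆) (A ∖ ⁅ v ⁆)) z
    gz′ = subst (λ V → Greedy V (contract (contract g ⁅ v ⁆) (A ∖ ⁅ v ⁆)) z) (sym U∖v∖A∖v≡U∖A)
            (Greedy-cong₀ gz (λ {Y} _ → sym (trans (contract-contract g ⁅ v ⁆ (A ∖ ⁅ v ⁆) Y)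
                                                (cong (λ B → contract g B Y) (⊆⇒∖∪≡ (⁅⁆-⊆ v∈A)))))
                             (λ _ → refl))
    piecewise-agrees : ∀ {u} → u ∈ U ∖ ⁅ v ⁆ → piecewise (A ∖ ⁅ v ⁆) y z u ≡ piecewise A y z u
    piecewise-agrees {u} u∈U∖v with u SP.∈? A
    ... | yes u∈A = trans (piecewise-∈ y z (∖⁺ u∈A (proj₂ (∖⁻ u∈U∖v)))) (sym (piecewise-∈ y z u∈A))
    ... | no u∉A  = trans (piecewise-∉ y z (u∉A ∘ ∖-⊆)) (sym (piecewise-∉ y z u∉A))

  Splits : Subset n → (Subset n → ℚ) → (Fin n → ℚ) → Set
  Splits U g y = ∀ {A B gA gB} c → U ≡ A ∪ B → Disjoint A B → DependsOnlyOn A gA → DependsOnlyOn B gB →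
                 (∀ {Y} → Y ⊆ U → g Y ≡ gA Y + gB Y + c) → Greedy A gA y × Greedy B gB y

  Splits-pick : ∀ {U g y v} → v ∈ U → y v ≡ g ⁅ v ⁆ - g ⊥ → Splits (U ∖ ⁅ v ⁆) (contract g ⁅ v ⁆) y →
                ∀ {A B gA gB} c → U ≡ A ∪ B → Disjoint A B → DependsOnlyOn A gA → DependsOnlyOn B gB →
                (∀ {Y} → Y ⊆ U → g Y ≡ gA Y + gB Y + c) → v ∈ A → Greedy A gA y × Greedy B gB y
  Splits-pick {U} {g} {y} {v} v∈U yv rest-splits {A} {B} {gA} {gB} c refl A#B gA-local gB-local g≗ v∈A =
    pick v v∈A yvA (proj₁ rest) , proj₂ rest
    where
    open ≡-Reasoning
    v∉B = A#B v∈A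
    gB[v] : gB ⁅ v ⁆ ≡ gB ⊥
    gB[v] = trans (cong gB (sym (SP.∪-identityˡ ⁅ v ⁆))) (DependsOnlyOn-∪⁅⁆ v∉B gB-local ⊥)
    yvA : y v ≡ gA ⁅ v ⁆ - gA ⊥
    yvA = begin
      y v                                           ≡⟨ yv ⟩
      g ⁅ v ⁆ - g ⊥                                 ≡⟨ cong₂ _-_ (g≗ (⁅⁆-⊆ v∈U)) (g≗ SP.⊥⊆) ⟩
      (gA ⁅ v ⁆ + gB ⁅ v ⁆ + c) - (gA ⊥ + gB ⊥ + c)  ≡⟨ cong (λ b → (gA ⁅ v ⁆ + b + c) - (gA ⊥ + gB ⊥ + c)) gB[v] ⟩
      (gA ⁅ v ⁆ + gB ⊥ + c) - (gA ⊥ + gB ⊥ + c)      ≡⟨ solve 4 (λ a b c a′ → (a :+ b :+ c) :- (a′ :+ b :+ c) := a :- a′)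
                                                             refl (gA ⁅ v ⁆) (gB ⊥) c (gA ⊥) ⟩
      gA ⁅ v ⁆ - gA ⊥                               ∎
    A∪B∖v : (A ∪ B) ∖ ⁅ v ⁆ ≡ (A ∖ ⁅ v ⁆) ∪ B
    A∪B∖v = SP.⊆-antisym
      (λ m → [ (λ x∈A → ∪⁺ˡ (∖⁺ x∈A (proj₂ (∖⁻ m)))) , ∪⁺ʳ ]′ (∪⁻ (∖-⊆ m)))
      (λ m → [ (λ x∈A∖v → ∖⁺ (∪⁺ˡ (∖-⊆ x∈A∖v)) (proj₂ (∖⁻ x∈A∖v)))
             , (λ x∈B → ∖⁺ (∪⁺ʳ x∈B) (λ x∈⁅v⁆ → v∉B (subst (_∈ B) (SP.x∈⁅y⁆⇒x≡y v x∈⁅v⁆) x∈B))) ]′ (∪⁻ m))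
    contract≗ : ∀ {Y} → Y ⊆ (A ∪ B) ∖ ⁅ v ⁆ → contract g ⁅ v ⁆ Y ≡ contract gA ⁅ v ⁆ Y + gB Y + (- gB ⊥)
    contract≗ {Y} Y⊆ = begin
      g (Y ∪ ⁅ v ⁆) - g ⁅ v ⁆
        ≡⟨ cong₂ _-_ (g≗ (λ m → [ ∖-⊆ ∘ Y⊆ , ⁅⁆-⊆ v∈U ]′ (∪⁻ m))) (g≗ (⁅⁆-⊆ v∈U)) ⟩
      (gA (Y ∪ ⁅ v ⁆) + gB (Y ∪ ⁅ v ⁆) + c) - (gA ⁅ v ⁆ + gB ⁅ v ⁆ + c)
        ≡⟨ cong₂ (λ p q → (gA (Y ∪ ⁅ v ⁆) + p + c) - (gA ⁅ v ⁆ + q + c)) (DependsOnlyOn-∪⁅⁆ v∉B gB-local Y) gB[v] ⟩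
      (gA (Y ∪ ⁅ v ⁆) + gB Y + c) - (gA ⁅ v ⁆ + gB ⊥ + c)
        ≡⟨ solve 5 (λ a b c a′ b′ → (a :+ b :+ c) :- (a′ :+ b′ :+ c) := (a :- a′) :+ b :+ (:- b′))
                 refl (gA (Y ∪ ⁅ v ⁆)) (gB Y) c (gA ⁅ v ⁆) (gB ⊥) ⟩
      contract gA ⁅ v ⁆ Y + gB Y + (- gB ⊥) ∎
    rest = rest-splits (- gB ⊥) A∪B∖v (A#B ∘ ∖-⊆) (DependsOnlyOn-contract v∈A gA-local) gB-local contract≗

  Greedy-split : ∀ {U g y} → Greedy U g y → Splits U g y
  Greedy-split (done U=∅) c refl _ _ _ _ =
    done (λ (x , x∈A) → U=∅ (x , ∪⁺ˡ x∈A)) , done (λ (x , x∈B) → U=∅ (x , ∪⁺ʳ x∈B))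
  Greedy-split (pick v v∈U yv rest) {A} {B} {gA} {gB} c refl A#B gA-local gB-local g≗ with ∪⁻ v∈U
  ... | inj₁ v∈A = Splits-pick v∈U yv (Greedy-split rest) c refl A#B gA-local gB-local g≗ v∈A
  ... | inj₂ v∈B = swap (Splits-pick v∈U yv (Greedy-split rest) c (SP.∪-comm A B) (λ x∈B x∈A → A#B x∈A x∈B)
                          gB-local gA-local (λ Y⊆ → trans (g≗ Y⊆) (cong (_+ c) (QP.+-comm (gA _) (gB _)))) v∈B)

  Greedy-split-⋃ : ∀ cs {g y} (f : Subset n → Subset n → ℚ) c → Greedy (⋃ cs) g y → AllPairs Disjoint cs →
                   All (λ C → DependsOnlyOn C (f C)) cs → (∀ {Y} → Y ⊆ ⋃ cs → g Y ≡ ∑ cs (λ C → f C Y) + c) →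
                   All (λ C → Greedy C (f C) y) cs
  Greedy-split-⋃ []       f c gr []            []                      g≗ = []
  Greedy-split-⋃ (C ∷ cs) f c gr (C#cs ∷ disj) (fC-local ∷ fcs-local) g≗ =
    proj₁ halves ∷ Greedy-split-⋃ cs f 0ℚ (proj₂ halves) disj fcs-local (λ _ → sym (QP.+-identityʳ _))
    where
    halves = Greedy-split gr c refl (Disjoint-⋃ C#cs) fC-local (DependsOnlyOn-∑ cs fcs-local) g≗

-- Base polytopes are spanned by greedy vectors

module _ {n : ℕ} where

  record Weighted (P : (Fin n → ℚ) → Set) : Set where
    constructor weighted
    field
      weight   : ℚ
      0≤weight : 0ℚ ≤ℚ weight
      point    : Fin n → ℚ
      valid    : P point

  open Weighted

  combination : ∀ {P} → List (Weighted P) → Fin n → ℚ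
  combination ps u = ∑ ps (λ p → weight p * point p u)

  InConv : ((Fin n → ℚ) → Set) → Subset n → (Fin n → ℚ) → Set
  InConv P U x = Σ (List (Weighted P)) λ ps → ∑ ps weight ≡ 1ℚ × (∀ {u} → u ∈ U → x u ≡ combination ps u)

  InConv-point : ∀ {P U x y} → P y → (∀ {u} → u ∈ U → x u ≡ y u) → InConv P U x
  InConv-point {y = y} Py x≗y = (weighted 1ℚ 0≤1 y Py ∷ []) , QP.+-identityʳ 1ℚ ,
    λ u∈U → trans (x≗y u∈U) (sym (trans (QP.+-identityʳ _) (QP.*-identityˡ _)))

  InConv-cong : ∀ {P} {U : Subset n} {x x′} → (∀ {u} → u ∈ U → x u ≡ x′ u) → InConv P U x′ → InConv P U x
  InConv-cong x≗x′ (ps , Σps≡1 , x′≗) = ps , Σps≡1 , λ u∈U → trans (x≗x′ u∈U) (x′≗ u∈U)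

  InConv-mix : ∀ {P U x x₁ x₂} α β → 0ℚ ≤ℚ α → 0ℚ ≤ℚ β → α + β ≡ 1ℚ →
               InConv P U x₁ → InConv P U x₂ → (∀ {u} → u ∈ U → x u ≡ α * x₁ u + β * x₂ u) → InConv P U x
  InConv-mix {P} {U} {x} {x₁} {x₂} α β 0≤α 0≤β α+β≡1 (ps , Σps≡1 , x₁≗) (qs , Σqs≡1 , x₂≗) x≗ =
    items , total , x≗combination
    where
    open ≡-Reasoning
    scale : ∀ c → 0ℚ ≤ℚ c → Weighted P → Weighted P
    scale c 0≤c (weighted λ₀ 0≤λ₀ y Py) = weighted (c * λ₀) (0≤* 0≤c 0≤λ₀) y Py
    ∑-scale : ∀ c 0≤c rs (f : Weighted P → ℚ) → (∀ r → f (scale c 0≤c r) ≡ c * f r) →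
              ∑ (List.map (scale c 0≤c) rs) f ≡ c * ∑ rs f
    ∑-scale c 0≤c rs f f-scale = trans (∑-map (scale c 0≤c) rs f) (trans (∑-cong rs f-scale) (∑-*ˡ c rs f))
    items = List.map (scale α 0≤α) ps List.++ List.map (scale β 0≤β) qs
    ∑-mixed : ∀ f → (∀ c 0≤c r → f (scale c 0≤c r) ≡ c * f r) → ∑ items f ≡ α * ∑ ps f + β * ∑ qs f
    ∑-mixed f f-scale = trans (∑-++ (List.map (scale α 0≤α) ps) _ f)
                              (cong₂ _+_ (∑-scale α 0≤α ps f (f-scale α 0≤α)) (∑-scale β 0≤β qs f (f-scale β 0≤β)))
    total : ∑ items weight ≡ 1ℚ
    total = begin
      ∑ items weight                      ≡⟨ ∑-mixed weight (λ _ _ _ → refl) ⟩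
      α * ∑ ps weight + β * ∑ qs weight   ≡⟨ cong₂ (λ a b → α * a + β * b) Σps≡1 Σqs≡1 ⟩
      α * 1ℚ + β * 1ℚ                     ≡⟨ cong₂ _+_ (QP.*-identityʳ α) (QP.*-identityʳ β) ⟩
      α + β                               ≡⟨ α+β≡1 ⟩
      1ℚ                                  ∎
    x≗combination : ∀ {u} → u ∈ U → x u ≡ combination items u
    x≗combination {u} u∈U = begin
      x u
        ≡⟨ x≗ u∈U ⟩
      α * x₁ u + β * x₂ u
        ≡⟨ cong₂ (λ a b → α * a + β * b) (x₁≗ u∈U) (x₂≗ u∈U) ⟩
      α * combination ps u + β * combination qs u
        ≡⟨ ∑-mixed (λ r → weight r * point r u) (λ c _ r → QP.*-assoc c _ _) ⟨
      combination items u ∎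

  InConv-piecewise : ∀ {P₁ P₂ P : (Fin n → ℚ) → Set} {A U x} → (∀ {y z} → P₁ y → P₂ z → P (piecewise A y z)) →
                     InConv P₁ A x → InConv P₂ (U ∖ A) x → InConv P U x
  InConv-piecewise {P₁} {P₂} {P} {A} {U} {x} glue (ps , Σps≡1 , x≗ps) (qs , Σqs≡1 , x≗qs) =
    items , total , x≗combination
    where
    open ≡-Reasoning
    pair : Weighted P₁ → Weighted P₂ → Weighted P
    pair (weighted λ₁ 0≤λ₁ y Py) (weighted λ₂ 0≤λ₂ z Pz) =
      weighted (λ₁ * λ₂) (0≤* 0≤λ₁ 0≤λ₂) (piecewise A y z) (glue Py Pz)
    items = List.cartesianProductWith pair ps qs
    total : ∑ items weight ≡ 1ℚ
    total = begin
      ∑ items weight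
        ≡⟨ ∑-cartesianProductWith pair ps qs weight ⟩
      ∑ ps (λ p → ∑ qs (λ q → weight p * weight q))
        ≡⟨ ∑-cong ps (λ p → ∑-*ˡ (weight p) qs weight) ⟩
      ∑ ps (λ p → weight p * ∑ qs weight)
        ≡⟨ ∑-cong ps (λ p → trans (cong (weight p *_) Σqs≡1) (QP.*-identityʳ _)) ⟩
      ∑ ps weight
        ≡⟨ Σps≡1 ⟩
      1ℚ ∎
    x≗combination : ∀ {u} → u ∈ U → x u ≡ combination items u
    x≗combination {u} u∈U with u SP.∈? A
    ... | yes u∈A = sym (begin
      combination items u
        ≡⟨ ∑-cartesianProductWith pair ps qs _ ⟩
      ∑ ps (λ p → ∑ qs (λ q → weight p * weight q * piecewise A (point p) (point q) u))
        ≡⟨ ∑-cong ps (λ p → ∑-cong qs (λ q → on-A p q)) ⟩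
      ∑ ps (λ p → ∑ qs (λ q → weight p * point p u * weight q))
        ≡⟨ ∑-cong ps (λ p → ∑-*ˡ (weight p * point p u) qs weight) ⟩
      ∑ ps (λ p → weight p * point p u * ∑ qs weight)
        ≡⟨ ∑-cong ps (λ p → trans (cong (weight p * point p u *_) Σqs≡1) (QP.*-identityʳ _)) ⟩
      combination ps u
        ≡⟨ x≗ps u∈A ⟨
      x u ∎)
      where
      on-A : ∀ p q → weight p * weight q * piecewise A (point p) (point q) u ≡ weight p * point p u * weight q
      on-A p q = trans (cong (weight p * weight q *_) (piecewise-∈ (point p) (point q) u∈A))
        (solve 3 (λ a b c → a :* b :* c := a :* c :* b) refl (weight p) (weight q) (point p u))
    ... | no u∉A = sym (begin
      combination items u
        ≡⟨ ∑-cartesianProductWith pair ps qs _ ⟩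
      ∑ ps (λ p → ∑ qs (λ q → weight p * weight q * piecewise A (point p) (point q) u))
        ≡⟨ ∑-cong ps (λ p → ∑-cong qs (λ q → off-A p q)) ⟩
      ∑ ps (λ p → ∑ qs (λ q → weight p * (weight q * point q u)))
        ≡⟨ ∑-cong ps (λ p → ∑-*ˡ (weight p) qs _) ⟩
      ∑ ps (λ p → weight p * combination qs u)
        ≡⟨ ∑-*ʳ (combination qs u) ps weight ⟩
      ∑ ps weight * combination qs u
        ≡⟨ trans (cong (_* combination qs u) Σps≡1) (QP.*-identityˡ _) ⟩
      combination qs u
        ≡⟨ x≗qs (∖⁺ u∈U u∉A) ⟨
      x u ∎)
      where
      off-A : ∀ p q → weight p * weight q * piecewise A (point p) (point q) u ≡ weight p * (weight q * point q u)
      off-A p q = trans (cong (weight p * weight q *_) (piecewise-∉ (point p) (point q) u∉A))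
        (QP.*-assoc (weight p) (weight q) (point q u))

allSubsets : ∀ n → List (Subset n)
allSubsets zero    = [] ∷ []
allSubsets (suc n) = List.map (true ∷_) (allSubsets n) List.++ List.map (false ∷_) (allSubsets n)

∈-allSubsets : ∀ {n} (X : Subset n) → X ∈ₗ allSubsets n
∈-allSubsets []          = here refl
∈-allSubsets (true ∷ X)  = ListMemP.∈-++⁺ˡ (ListMemP.∈-map⁺ (true ∷_) (∈-allSubsets X))
∈-allSubsets (false ∷ X) =
  ListMemP.∈-++⁺ʳ (List.map (true ∷_) (allSubsets _)) (ListMemP.∈-map⁺ (false ∷_) (∈-allSubsets X))

argmin-Subset : ∀ {n} {P : Subset n → Set} → (∀ X → Dec (P X)) → (f : Subset n → ℚ) → ∀ {X₀} → P X₀ →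
                Σ (Subset n) λ A → P A × (∀ {X} → P X → f A ≤ℚ f X)
argmin-Subset {n} {P} P? f {X₀} PX₀ =
  argmin f X₀ candidates ,
  argmin-all f PX₀ (AllP.all-filter P? (allSubsets n)) ,
  λ {X} PX → All.lookup (f[argmin]≤f[xs] X₀ candidates) (ListMemP.∈-filter⁺ P? (∈-allSubsets X) PX)
  where
  candidates = List.filter P? (allSubsets n)

module _ {n : ℕ} where

  InBasePolytope : Subset n → (Subset n → ℚ) → (Fin n → ℚ) → Set
  InBasePolytope U g x = (∀ {X} → X ⊆ U → x ⟨ X ⟩ ≤ℚ g X) × x ⟨ U ⟩ ≡ g U

  module _ {U A : Subset n} {g : Subset n → ℚ} {x : Fin n → ℚ}
           (base : InBasePolytope U g x) (A⊆U : A ⊆ U) (A-tight : x ⟨ A ⟩ ≡ g A) where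

    InBasePolytope-restrict : InBasePolytope A g x
    InBasePolytope-restrict = (λ X⊆A → proj₁ base (A⊆U ∘ X⊆A)) , A-tight

    InBasePolytope-contract : InBasePolytope (U ∖ A) (contract g A) x
    InBasePolytope-contract = bound , total
      where
      bound : ∀ {X} → X ⊆ U ∖ A → x ⟨ X ⟩ ≤ℚ contract g A X
      bound {X} X⊆U∖A = QP.≤-trans (p+q≤r⇒p≤r-q (begin
        (x ⟨ X ⟩ + x ⟨ A ⟩)  ≡⟨ ⟨⟩-∪-disjoint x (proj₂ ∘ ∖⁻ ∘ X⊆U∖A) ⟨
        (x ⟨ X ∪ A ⟩)        ≤⟨ proj₁ base (λ m → [ ∖-⊆ ∘ X⊆U∖A , A⊆U ]′ (∪⁻ m)) ⟩
        g (X ∪ A)            ∎))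
        (QP.≤-reflexive (cong (λ c → g (X ∪ A) - c) A-tight))
        where open QP.≤-Reasoning
      total : x ⟨ U ∖ A ⟩ ≡ contract g A (U ∖ A)
      total = begin
        (x ⟨ U ∖ A ⟩)                         ≡⟨ solve 2 (λ a b → b := (a :+ b) :- a) refl (x ⟨ A ⟩) (x ⟨ U ∖ A ⟩) ⟩
        (x ⟨ A ⟩ + x ⟨ U ∖ A ⟩ - x ⟨ A ⟩)      ≡⟨ cong (λ B → x ⟨ B ⟩ + x ⟨ U ∖ A ⟩ - x ⟨ A ⟩) (⊆⇒∩≡ A⊆U) ⟨
        (x ⟨ U ∩ A ⟩ + x ⟨ U ∖ A ⟩ - x ⟨ A ⟩)  ≡⟨ cong₂ _-_ (trans (sym (⟨⟩-split x U A)) (proj₂ base)) A-tight ⟩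
        g U - g A                             ≡⟨ cong (λ B → g B - g A) (⊆⇒∖∪≡ A⊆U) ⟨
        contract g A (U ∖ A)                  ∎
        where open ≡-Reasoning

  shift : (Fin n → ℚ) → Fin n → Fin n → ℚ → Fin n → ℚ
  shift x u v t w = x w + δ u t w + δ v (- t) w

  ⟨⟩-shift : ∀ x (u v : Fin n) t X → (shift x u v t) ⟨ X ⟩ ≡ x ⟨ X ⟩ + (δ u t) ⟨ X ⟩ + (δ v (- t)) ⟨ X ⟩
  ⟨⟩-shift x u v t X = trans (⟨⟩-+ (λ w → x w + δ u t w) (δ v (- t)) X)
                             (cong (_+ (δ v (- t)) ⟨ X ⟩) (⟨⟩-+ x (δ u t) X))

  shift-0 : ∀ x (u v : Fin n) w → shift x u v 0ℚ w ≡ x w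
  shift-0 x u v w = trans (cong₂ (λ a b → x w + a + b) (δ-0 u w) (δ-0 v w))
                          (solve 1 (λ a → a :+ con 0ℚ :+ con 0ℚ := a) refl (x w))

  shift-bounded : ∀ {U g x u v t} → InBasePolytope U g x → 0ℚ ≤ℚ t →
                  (∀ {X} → X ⊆ U → u ∈ X → v ∉ X → t ≤ℚ g X - x ⟨ X ⟩) →
                  ∀ {X} → X ⊆ U → (shift x u v t) ⟨ X ⟩ ≤ℚ g X
  shift-bounded {U} {g} {x} {u} {v} {t} (x≤g , _) 0≤t t≤slack {X} X⊆U =
    QP.≤-trans (QP.≤-reflexive (⟨⟩-shift x u v t X)) (by-cases (u SP.∈? X) (v SP.∈? X))
    where
    open QP.≤-Reasoning
    by-cases : Dec (u ∈ X) → Dec (v ∈ X) → x ⟨ X ⟩ + (δ u t) ⟨ X ⟩ + (δ v (- t)) ⟨ X ⟩ ≤ℚ g X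
    by-cases (yes u∈X) (no v∉X) = begin
      x ⟨ X ⟩ + (δ u t) ⟨ X ⟩ + (δ v (- t)) ⟨ X ⟩
        ≡⟨ cong₂ (λ a b → x ⟨ X ⟩ + a + b) (⟨⟩-δ-∈ t u∈X) (⟨⟩-δ-∉ (- t) v∉X) ⟩
      x ⟨ X ⟩ + t + 0ℚ
        ≤⟨ QP.+-monoˡ-≤ 0ℚ (QP.+-monoʳ-≤ (x ⟨ X ⟩) (t≤slack X⊆U u∈X v∉X)) ⟩
      x ⟨ X ⟩ + (g X - x ⟨ X ⟩) + 0ℚ
        ≡⟨ solve 2 (λ a b → a :+ (b :- a) :+ con 0ℚ := b) refl (x ⟨ X ⟩) (g X) ⟩
      g X ∎
    by-cases (yes u∈X) (yes v∈X) = begin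
      x ⟨ X ⟩ + (δ u t) ⟨ X ⟩ + (δ v (- t)) ⟨ X ⟩
        ≡⟨ cong₂ (λ a b → x ⟨ X ⟩ + a + b) (⟨⟩-δ-∈ t u∈X) (⟨⟩-δ-∈ (- t) v∈X) ⟩
      x ⟨ X ⟩ + t + - t
        ≡⟨ solve 2 (λ a t → a :+ t :+ (:- t) := a) refl (x ⟨ X ⟩) t ⟩
      x ⟨ X ⟩
        ≤⟨ x≤g X⊆U ⟩
      g X ∎
    by-cases (no u∉X) (no v∉X) = begin
      x ⟨ X ⟩ + (δ u t) ⟨ X ⟩ + (δ v (- t)) ⟨ X ⟩
        ≡⟨ cong₂ (λ a b → x ⟨ X ⟩ + a + b) (⟨⟩-δ-∉ t u∉X) (⟨⟩-δ-∉ (- t) v∉X) ⟩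
      x ⟨ X ⟩ + 0ℚ + 0ℚ
        ≡⟨ solve 1 (λ a → a :+ con 0ℚ :+ con 0ℚ := a) refl (x ⟨ X ⟩) ⟩
      x ⟨ X ⟩
        ≤⟨ x≤g X⊆U ⟩
      g X ∎
    by-cases (no u∉X) (yes v∈X) = begin
      x ⟨ X ⟩ + (δ u t) ⟨ X ⟩ + (δ v (- t)) ⟨ X ⟩
        ≡⟨ cong₂ (λ a b → x ⟨ X ⟩ + a + b) (⟨⟩-δ-∉ t u∉X) (⟨⟩-δ-∈ (- t) v∈X) ⟩
      x ⟨ X ⟩ + 0ℚ + - t
        ≡⟨ cong (_- t) (QP.+-identityʳ (x ⟨ X ⟩)) ⟩
      x ⟨ X ⟩ - t
        ≤⟨ p-q≤p (x ⟨ X ⟩) 0≤t ⟩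
      x ⟨ X ⟩
        ≤⟨ x≤g X⊆U ⟩
      g X ∎

  record TightShift (U : Subset n) (g : Subset n → ℚ) (x : Fin n → ℚ) (u v : Fin n) : Set where
    field
      A       : Subset n
      t       : ℚ
      A⊆U     : A ⊆ U
      u∈A     : u ∈ A
      v∉A     : v ∉ A
      0≤t     : 0ℚ ≤ℚ t
      base    : InBasePolytope U g (shift x u v t)
      A-tight : (shift x u v t) ⟨ A ⟩ ≡ g A

  -- t is the least slack g X - x(X) over the sets X separating u from v
  tightShift : ∀ {U g x u v} → u ∈ U → v ∈ U → u ≢ v → InBasePolytope U g x → TightShift U g x u v
  tightShift {U} {g} {x} {u} {v} u∈U v∈U u≢v base@(x≤g , x⟨U⟩≡gU) = record
    { A = A ; t = slack A ; A⊆U = A⊆U ; u∈A = u∈A ; v∉A = v∉A ; 0≤t = 0≤slack A⊆U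
    ; base = shift-bounded base (0≤slack A⊆U) (λ X⊆U u∈X v∉X → A-minimal (X⊆U , u∈X , v∉X)) , total
    ; A-tight = tight }
    where
    Separates : Subset n → Set
    Separates X = X ⊆ U × u ∈ X × v ∉ X
    slack : Subset n → ℚ
    slack X = g X - x ⟨ X ⟩
    0≤slack : ∀ {X} → X ⊆ U → 0ℚ ≤ℚ slack X
    0≤slack {X} X⊆U =
      QP.≤-trans (QP.≤-reflexive (sym (QP.+-inverseʳ (x ⟨ X ⟩)))) (QP.+-monoˡ-≤ (- x ⟨ X ⟩) (x≤g X⊆U))
    minimal = argmin-Subset (λ X → (X SP.⊆? U) ×-dec (u SP.∈? X) ×-dec ¬? (v SP.∈? X)) slack
                {⁅ u ⁆} (⁅⁆-⊆ u∈U , SP.x∈⁅x⁆ u , u≢v ∘ sym ∘ SP.x∈⁅y⁆⇒x≡y u)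
    A = proj₁ minimal
    A⊆U = proj₁ (proj₁ (proj₂ minimal))
    u∈A = proj₁ (proj₂ (proj₁ (proj₂ minimal)))
    v∉A = proj₂ (proj₂ (proj₁ (proj₂ minimal)))
    A-minimal : ∀ {X} → Separates X → slack A ≤ℚ slack X
    A-minimal = proj₂ (proj₂ minimal)
    open ≡-Reasoning
    total : (shift x u v (slack A)) ⟨ U ⟩ ≡ g U
    total = begin
      (shift x u v (slack A)) ⟨ U ⟩
        ≡⟨ ⟨⟩-shift x u v (slack A) U ⟩
      (x ⟨ U ⟩ + (δ u (slack A)) ⟨ U ⟩ + (δ v (- slack A)) ⟨ U ⟩)
        ≡⟨ cong₂ (λ a b → x ⟨ U ⟩ + a + b) (⟨⟩-δ-∈ (slack A) u∈U) (⟨⟩-δ-∈ (- slack A) v∈U) ⟩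
      (x ⟨ U ⟩ + slack A + - slack A)
        ≡⟨ solve 2 (λ a t → a :+ t :+ (:- t) := a) refl (x ⟨ U ⟩) (slack A) ⟩
      (x ⟨ U ⟩)
        ≡⟨ x⟨U⟩≡gU ⟩
      g U ∎
    tight : (shift x u v (slack A)) ⟨ A ⟩ ≡ g A
    tight = begin
      (shift x u v (slack A)) ⟨ A ⟩
        ≡⟨ ⟨⟩-shift x u v (slack A) A ⟩
      (x ⟨ A ⟩ + (δ u (slack A)) ⟨ A ⟩ + (δ v (- slack A)) ⟨ A ⟩)
        ≡⟨ cong₂ (λ a b → x ⟨ A ⟩ + a + b) (⟨⟩-δ-∈ (slack A) u∈A) (⟨⟩-δ-∉ (- slack A) v∉A) ⟩
      (x ⟨ A ⟩ + slack A + 0ℚ)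
        ≡⟨ solve 2 (λ a b → a :+ (b :- a) :+ con 0ℚ := b) refl (x ⟨ A ⟩) (g A) ⟩
      g A ∎

  shift-segment : ∀ x (u v : Fin n) {t s α β} → α + β ≡ 1ℚ → α * t ≡ β * s →
                  ∀ w → x w ≡ α * shift x u v t w + β * shift x v u s w
  shift-segment x u v {t} {s} {α} {β} α+β≡1 αt≡βs w = sym (begin
    α * shift x u v t w + β * shift x v u s w
      ≡⟨ solve 7 (λ α β x a b c d → α :* (x :+ a :+ b) :+ β :* (x :+ c :+ d)
                                    := (α :+ β) :* x :+ (α :* a :+ β :* d) :+ (α :* b :+ β :* c))
               refl α β (x w) (δ u t w) (δ v (- t) w) (δ v s w) (δ u (- s) w) ⟩
    (α + β) * x w + (α * δ u t w + β * δ u (- s) w) + (α * δ v (- t) w + β * δ v s w)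
      ≡⟨ cong₂ (λ p q → (α + β) * x w + p + q) (δ-linear α β u t (- s) w) (δ-linear α β v (- t) s w) ⟩
    (α + β) * x w + δ u (α * t + β * - s) w + δ v (α * - t + β * s) w
      ≡⟨ cong₂ (λ p q → (α + β) * x w + δ u p w + δ v q w) balance-u balance-v ⟩
    (α + β) * x w + δ u 0ℚ w + δ v 0ℚ w
      ≡⟨ cong (λ a → a * x w + δ u 0ℚ w + δ v 0ℚ w) α+β≡1 ⟩
    1ℚ * x w + δ u 0ℚ w + δ v 0ℚ w
      ≡⟨ cong₂ (λ p q → 1ℚ * x w + p + q) (δ-0 u w) (δ-0 v w) ⟩
    1ℚ * x w + 0ℚ + 0ℚ
      ≡⟨ solve 1 (λ a → con 1ℚ :* a :+ con 0ℚ :+ con 0ℚ := a) refl (x w) ⟩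
    x w ∎)
    where
    open ≡-Reasoning
    balance-u : α * t + β * - s ≡ 0ℚ
    balance-u = trans (cong (_+ β * - s) αt≡βs) (solve 2 (λ b s → b :* s :+ b :* (:- s) := con 0ℚ) refl β s)
    balance-v : α * - t + β * s ≡ 0ℚ
    balance-v = trans (cong (α * - t +_) (sym αt≡βs)) (solve 2 (λ a t → a :* (:- t) :+ a :* t := con 0ℚ) refl α t)

  Greedy-singleton : ∀ {U g x u} → u ∈ U → (∀ {v} → v ∈ U → v ≡ u) → g ⊥ ≡ 0ℚ → InBasePolytope U g x →
                     Greedy U g x
  Greedy-singleton {U} {g} {x} {u} u∈U only-u g⊥≡0 (_ , x⟨U⟩≡gU) = pick u u∈U x[u] (done U∖u=∅)
    where
    U≡⁅u⁆ : U ≡ ⁅ u ⁆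
    U≡⁅u⁆ = SP.⊆-antisym (λ v∈U → subst (_∈ ⁅ u ⁆) (sym (only-u v∈U)) (SP.x∈⁅x⁆ u)) (⁅⁆-⊆ u∈U)
    x[u] : x u ≡ g ⁅ u ⁆ - g ⊥
    x[u] = begin
      x u              ≡⟨ ⟨⟩-⁅⁆ x u ⟨
      (x ⟨ ⁅ u ⁆ ⟩)    ≡⟨ cong (x ⟨_⟩) U≡⁅u⁆ ⟨
      (x ⟨ U ⟩)        ≡⟨ x⟨U⟩≡gU ⟩
      g U              ≡⟨ cong g U≡⁅u⁆ ⟩
      g ⁅ u ⁆          ≡⟨ QP.+-identityʳ _ ⟨
      g ⁅ u ⁆ - 0ℚ     ≡⟨ cong (λ c → g ⁅ u ⁆ - c) g⊥≡0 ⟨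
      g ⁅ u ⁆ - g ⊥    ∎
      where open ≡-Reasoning
    U∖u=∅ : Empty (U ∖ ⁅ u ⁆)
    U∖u=∅ (v , v∈U∖u) = proj₂ (∖⁻ v∈U∖u) (subst (_∈ ⁅ u ⁆) (sym (only-u (∖-⊆ v∈U∖u))) (SP.x∈⁅x⁆ u))

  Decomposable : Subset n → Set
  Decomposable U = ∀ g x → g ⊥ ≡ 0ℚ → InBasePolytope U g x → InConv (Greedy U g) U x

  module _ {U : Subset n} (IH : ∀ {V} → V ⊂ U → Decomposable V) {g : Subset n → ℚ} (g⊥≡0 : g ⊥ ≡ 0ℚ) where

    decompose-at-tight : ∀ {x} → InBasePolytope U g x → ∀ {A a b} → A ⊆ U → a ∈ A → b ∈ U → b ∉ A →
                         x ⟨ A ⟩ ≡ g A → InConv (Greedy U g) U x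
    decompose-at-tight {x} base {A} A⊆U a∈A b∈U b∉A A-tight = InConv-piecewise (Greedy-glue A⊆U)
      (IH (A⊆U , _ , b∈U , b∉A) g x g⊥≡0 (InBasePolytope-restrict base A⊆U A-tight))
      (IH (∖-⊂ (A⊆U a∈A) a∈A) (contract g A) x contract⊥≡0 (InBasePolytope-contract base A⊆U A-tight))
      where
      contract⊥≡0 : contract g A ⊥ ≡ 0ℚ
      contract⊥≡0 = trans (cong (λ B → g B - g A) (SP.∪-identityˡ A)) (QP.+-inverseʳ (g A))

    decompose-at-shift : ∀ {x u v} (R : TightShift U g x u v) → v ∈ U →
                         InConv (Greedy U g) U (shift x u v (TightShift.t R))
    decompose-at-shift R v∈U = decompose-at-tight base A⊆U u∈A v∈U v∉A A-tight
      where open TightShift R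

    -- x = (s · x₁ + t · x₂) / (t + s) for the shifts x₁ = x + t(e_u - e_v) and x₂ = x + s(e_v - e_u)
    decompose-two-points : ∀ {x} → InBasePolytope U g x → ∀ {u v} → u ∈ U → v ∈ U → u ≢ v →
                           InConv (Greedy U g) U x
    decompose-two-points {x} base {u} {v} u∈U v∈U u≢v = by-sign (0≤⇒≡0⊎0< (TightShift.0≤t R₁))
      where
      R₁ = tightShift u∈U v∈U u≢v base
      R₂ = tightShift v∈U u∈U (u≢v ∘ sym) base
      t = TightShift.t R₁
      s = TightShift.t R₂
      by-sign : t ≡ 0ℚ ⊎ 0ℚ < t → InConv (Greedy U g) U x
      by-sign (inj₁ t≡0) = InConv-cong (λ {w} _ → sym (trans (cong (λ t → shift x u v t w) t≡0) (shift-0 x u v w)))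
                                       (decompose-at-shift R₁ v∈U)
      by-sign (inj₂ 0<t) = InConv-mix α β (0≤* (TightShift.0≤t R₂) 0≤i) (0≤* (TightShift.0≤t R₁) 0≤i) α+β≡1
                             (decompose-at-shift R₁ v∈U) (decompose-at-shift R₂ u∈U)
                             (λ {w} _ → shift-segment x u v {t} {s} {α} {β} α+β≡1 αt≡βs w)
        where
        0<t+s : 0ℚ < t + s
        0<t+s = QP.+-mono-<-≤ 0<t (TightShift.0≤t R₂)
        instance
          t+s≢0 : NonZero (t + s)
          t+s≢0 = QP.pos⇒nonZero (t + s) {{positive 0<t+s}}
        i = 1/ (t + s)
        0≤i : 0ℚ ≤ℚ i
        0≤i = QP.nonNegative⁻¹ i {{QP.pos⇒nonNeg i {{QP.1/pos⇒pos (t + s) {{positive 0<t+s}}}}}}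
        α = s * i
        β = t * i
        α+β≡1 : α + β ≡ 1ℚ
        α+β≡1 = trans (solve 3 (λ s t i → s :* i :+ t :* i := (t :+ s) :* i) refl s t i) (QP.*-inverseʳ (t + s))
        αt≡βs : α * t ≡ β * s
        αt≡βs = solve 3 (λ s t i → s :* i :* t := t :* i :* s) refl s t i

  InBasePolytope⇒InConv-Greedy : ∀ U → Decomposable U
  InBasePolytope⇒InConv-Greedy U = go U (⊂-wellFounded U)
    where
    go : ∀ U → Acc _⊂_ U → Decomposable U
    go U (acc rs) g x g⊥≡0 base with SP.nonempty? U
    ... | no U=∅ = InConv-point (done U=∅) (λ _ → refl)
    ... | yes (u , u∈U) with FinP.any? (λ v → (v SP.∈? U) ×-dec ¬? (v ≟ u))
    ...   | yes (v , v∈U , v≢u) = decompose-two-points (λ V⊂U → go _ (rs V⊂U)) g⊥≡0 base u∈U v∈U (v≢u ∘ sym)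
    ...   | no no-other = InConv-point (Greedy-singleton u∈U only-u g⊥≡0 base) (λ _ → refl)
      where
      only-u : ∀ {v} → v ∈ U → v ≡ u
      only-u {v} v∈U with v ≟ u
      ... | yes v≡u = v≡u
      ... | no v≢u  = ⊥-elim (no-other (v , v∈U , v≢u))

-- Greedy vectors of f are the vectors x^T

module _ {n : ℕ} (G : Graph n) where

  fOn-DependsOnlyOn : ∀ C → DependsOnlyOn C (fOn G C)
  fOn-DependsOnlyOn C Y Y′ eq = cong (λ Z → w ∣ C ∣ - componentSum G Z) (SP.⊆-antisym (C∖-⊆ eq) (C∖-⊆ (sym eq)))
    where
    C∖-⊆ : ∀ {Y Y′} → Y ∩ C ≡ Y′ ∩ C → C ∖ Y ⊆ C ∖ Y′
    C∖-⊆ eq m = ∖⁺ (∖-⊆ m) (λ x∈Y′ → proj₂ (∖⁻ m) (proj₁ (∩⁻ (subst (_ ∈_) (sym eq) (∩⁺ x∈Y′ (∖-⊆ m))))))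

  TreeFor : Subset n → (Fin n → ℚ) → Set
  TreeFor S y = Σ (ElimTree G S) λ t → ∀ {u} → u ∈ S → y u ≡ xT G t u

  forest : ∀ {W y} cs → All (IsComponent G W) cs → AllPairs Disjoint cs → All (λ C → Greedy C (fOn G C) y) cs →
           (∀ {C} → IsComponent G W C → Greedy C (fOn G C) y → TreeFor C y) →
           Σ (All (ElimTree G) cs) λ ts → ∀ {u} → u ∈ ⋃ cs → y u ≡ xTs G ts u
  forest []       []                  []            []           tree = [] , λ u∈⊥ → ⊥-elim (SP.∉⊥ u∈⊥)
  forest {y = y} (C ∷ cs) (C-comp ∷ cs-comp) (C#cs ∷ disj) (gC ∷ gcs) tree
    with tree C-comp gC | forest cs cs-comp disj gcs tree
  ... | t , y≗t | ts , y≗ts = t ∷ ts , y≗t+ts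
    where
    y≗t+ts : ∀ {u} → u ∈ C ∪ ⋃ cs → y u ≡ xT G t u + xTs G ts u
    y≗t+ts {u} u∈C∪⋃cs with u SP.∈? C
    ... | yes u∈C = trans (y≗t u∈C)
                          (sym (trans (cong (xT G t u +_) (xTs-outside G ts (Disjoint-⋃ C#cs u∈C))) (QP.+-identityʳ _)))
    ... | no u∉C  = trans (y≗ts ([ (λ u∈C → ⊥-elim (u∉C u∈C)) , id ]′ (∪⁻ u∈C∪⋃cs)))
                          (sym (trans (cong (_+ xTs G ts u) (xT-outside G t u∉C)) (QP.+-identityˡ _)))

  module _ {S : Subset n} {v : Fin n} {y : Fin n → ℚ} (v∈S : v ∈ S) (S-conn : ConnectedSet G S)
           (yv : y v ≡ fOn G S ⁅ v ⁆ - fOn G S ⊥)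
           (rest : Greedy (S ∖ ⁅ v ⁆) (contract (fOn G S) ⁅ v ⁆) y) where

    private
      cs = proj₁ (components G (S ∖ ⁅ v ⁆))
      cs-comp = proj₂ (components G (S ∖ ⁅ v ⁆))
      r = w ∣ S ∣ - sumW cs
      open ≡-Reasoning

    contract-fOn : ∀ {Y} → contract (fOn G S) ⁅ v ⁆ Y ≡ ∑ cs (λ C → fOn G C Y) + 0ℚ
    contract-fOn {Y} = begin
      ((w ∣ S ∣ - componentSum G (S ∖ (Y ∪ ⁅ v ⁆))) - (w ∣ S ∣ - componentSum G (S ∖ ⁅ v ⁆)))
        ≡⟨ solve 3 (λ a p q → (a :- p) :- (a :- q) := q :- p) refl
                 (w ∣ S ∣) (componentSum G (S ∖ (Y ∪ ⁅ v ⁆))) (componentSum G (S ∖ ⁅ v ⁆)) ⟩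
      componentSum G (S ∖ ⁅ v ⁆) - componentSum G (S ∖ (Y ∪ ⁅ v ⁆))
        ≡⟨ cong₂ (λ p Z → p - componentSum G Z) (sym (sumW-Components G cs-comp)) S∖Y∪v ⟩
      sumW cs - componentSum G ((S ∖ ⁅ v ⁆) ∖ Y)
        ≡⟨ cong₂ _-_ (sumW≡∑ cs) (componentSum-∖ G cs-comp Y) ⟩
      (∑ cs (w ∘ ∣_∣) - ∑ cs (λ C → componentSum G (C ∖ Y)))
        ≡⟨ ∑-− cs (w ∘ ∣_∣) (λ C → componentSum G (C ∖ Y)) ⟨
      ∑ cs (λ C → fOn G C Y)
        ≡⟨ QP.+-identityʳ _ ⟨
      ∑ cs (λ C → fOn G C Y) + 0ℚ ∎
      where
      S∖Y∪v : S ∖ (Y ∪ ⁅ v ⁆) ≡ (S ∖ ⁅ v ⁆) ∖ Y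
      S∖Y∪v = SP.⊆-antisym
        (λ m → ∖⁺ (∖⁺ (∖-⊆ m) (proj₂ (∖⁻ m) ∘ ∪⁺ʳ)) (proj₂ (∖⁻ m) ∘ ∪⁺ˡ))
        (λ m → ∖⁺ (∖-⊆ (∖-⊆ m)) (λ x∈Y∪v → [ proj₂ (∖⁻ m) , proj₂ (∖⁻ (∖-⊆ m)) ]′ (∪⁻ x∈Y∪v)))

    root-value : y v ≡ r
    root-value = begin
      y v                                                                        ≡⟨ yv ⟩
      ((w ∣ S ∣ - componentSum G (S ∖ ⁅ v ⁆)) - (w ∣ S ∣ - componentSum G (S ∖ ⊥)))
        ≡⟨ cong₂ (λ p q → (w ∣ S ∣ - p) - (w ∣ S ∣ - q)) (sym (sumW-Components G cs-comp))
                 (trans (cong (componentSum G) (p∖⊥≡p S)) (componentSum-connected G v∈S S-conn)) ⟩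
      ((w ∣ S ∣ - sumW cs) - (w ∣ S ∣ - (w ∣ S ∣)))
        ≡⟨ solve 2 (λ a b → (a :- b) :- (a :- a) := a :- b) refl (w ∣ S ∣) (sumW cs) ⟩
      r                                                                          ∎

    greedy-components : All (λ C → Greedy C (fOn G C) y) cs
    greedy-components = Greedy-split-⋃ cs (fOn G) 0ℚ
      (subst (λ V → Greedy V (contract (fOn G S) ⁅ v ⁆) y) (Components-⋃ G cs-comp) rest)
      (Components-disjoint G cs-comp) (All.universal fOn-DependsOnlyOn cs) (λ _ → contract-fOn)

    tree-with-root : (∀ {C} → IsComponent G (S ∖ ⁅ v ⁆) C → Greedy C (fOn G C) y → TreeFor C y) → TreeFor S y
    tree-with-root tree =
      node v v∈S cs cs-comp ts , λ {u} u∈S → trans (y≗ u∈S (u ≟ v)) (sym (xT-node G v∈S cs-comp ts u))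
      where
      children = forest cs (proj₁ cs-comp) (Components-disjoint G cs-comp) greedy-components tree
      ts = proj₁ children
      v∉⋃cs : v ∉ ⋃ cs
      v∉⋃cs v∈⋃cs = proj₂ (∖⁻ (⋃-Components G cs-comp v∈⋃cs)) (SP.x∈⁅x⁆ v)
      y≗ : ∀ {u} → u ∈ S → Dec (u ≡ v) → y u ≡ δ v r u + xTs G ts u
      y≗ {u} _ (yes refl) = begin
        y v                  ≡⟨ root-value ⟩
        r                    ≡⟨ QP.+-identityʳ r ⟨
        r + 0ℚ               ≡⟨ cong₂ _+_ (δ-diag v r) (xTs-outside G ts v∉⋃cs) ⟨
        δ v r v + xTs G ts v ∎
      y≗ {u} u∈S (no u≢v) = begin
        y u                  ≡⟨ proj₂ children (subst (u ∈_) (Components-⋃ G cs-comp) (∖⁺ u∈S (SP.x≢y⇒x∉⁅y⁆ u≢v))) ⟩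
        xTs G ts u           ≡⟨ QP.+-identityˡ _ ⟨
        0ℚ + xTs G ts u      ≡⟨ cong (_+ xTs G ts u) (δ-off r u≢v) ⟨
        δ v r u + xTs G ts u ∎

  Greedy⇒ElimTree : ∀ {S s y} → s ∈ S → ConnectedSet G S → Greedy S (fOn G S) y → TreeFor S y
  Greedy⇒ElimTree {S} = go S (⊂-wellFounded S)
    where
    go : ∀ S → Acc _⊂_ S → ∀ {s y} → s ∈ S → ConnectedSet G S → Greedy S (fOn G S) y → TreeFor S y
    go S _        s∈S _      (done S=∅)           = ⊥-elim (S=∅ (_ , s∈S))
    go S (acc rs) _   S-conn (pick v v∈S yv rest) = tree-with-root v∈S S-conn yv rest λ C-comp gC →
      go _ (rs (C⊂S C-comp)) (proj₂ (proj₁ C-comp)) (IsComponent-connected G C-comp) gC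
      where
      C⊂S : ∀ {C} → IsComponent G (S ∖ ⁅ v ⁆) C → C ⊂ S
      C⊂S C-comp = ∖-⊆ ∘ IsComponent-⊆ G C-comp , v , v∈S ,
                   λ v∈C → proj₂ (∖⁻ (IsComponent-⊆ G C-comp v∈C)) (SP.x∈⁅x⁆ v)

module _ {n : ℕ} (G : Graph n) where

  ⟨⟩-combo : ∀ ps X → (combo G ps) ⟨ X ⟩ ≡ ∑ ps (λ p → proj₁ p * (xT G (proj₂ p)) ⟨ X ⟩)
  ⟨⟩-combo []             X = ⟨⟩-≡0 {x = combo G []} X (λ _ → refl)
  ⟨⟩-combo ((l , t) ∷ ps) X = trans (⟨⟩-+ (λ u → l * xT G t u) (combo G ps) X)
                                    (cong₂ _+_ (⟨⟩-* l (xT G t) X) (⟨⟩-combo ps X))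

  weights≡∑ : ∀ ps → weights G ps ≡ ∑ ps proj₁
  weights≡∑ []            = refl
  weights≡∑ ((l , _) ∷ ps) = cong (l +_) (weights≡∑ ps)

module _ {m : ℕ} (G : Graph (suc m)) (G-conn : Connected G) where

  private
    n = suc m

  ⊤-connected : ConnectedSet G ⊤
  ⊤-connected {a} {b} _ _ = G-conn a b

  fval≡fOn : ∀ {X cs} → Components G (∁ X) cs → fval cs ≡ fOn G ⊤ X
  fval≡fOn {X} cs-comp = cong₂ _-_ (cong w (sym (SP.∣⊤∣≡n n)))
    (trans (sumW-Components G cs-comp) (cong (componentSum G) (sym (SP.∩-identityˡ (∁ X)))))

  fOn⊤⊥≡0 : fOn G ⊤ ⊥ ≡ 0ℚ
  fOn⊤⊥≡0 = trans (cong (λ c → w ∣ ⊤ {n} ∣ - c) (trans (cong (componentSum G) (p∖⊥≡p ⊤))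
                                                  (componentSum-connected G (SP.∈⊤ {x = Fin.zero}) ⊤-connected)))
                  (QP.+-inverseʳ (w ∣ ⊤ {n} ∣))

  InBase⇒InBasePolytope : ∀ {x} → InBase G x → InBasePolytope ⊤ (fOn G ⊤) x
  InBase⇒InBasePolytope {x} (x≤f , x⟨⊤⟩≡f) =
    (λ {X} _ → subst (x ⟨ X ⟩ ≤ℚ_) (fval≡fOn (comps X)) (x≤f X _ (comps X))) ,
    trans (x⟨⊤⟩≡f _ (comps ⊤)) (fval≡fOn (comps ⊤))
    where
    comps : ∀ X → Components G (∁ X) (proj₁ (components G (∁ X)))
    comps X = proj₂ (components G (∁ X))

  tree-of : ∀ {y} → Greedy ⊤ (fOn G ⊤) y → TreeFor G ⊤ y
  tree-of = Greedy⇒ElimTree G (SP.∈⊤ {x = Fin.zero}) ⊤-connected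

  InConv-Greedy⇒InConvHull : ∀ {x} → InConv (Greedy ⊤ (fOn G ⊤)) ⊤ x → InConvHull G x
  InConv-Greedy⇒InConvHull (ps , Σps≡1 , x≗) =
    List.map to-pair ps , AllP.map⁺ (All.universal Weighted.0≤weight ps) , trans (weights≡ ps) Σps≡1 ,
    λ u → trans (x≗ SP.∈⊤) (combo≡ ps u)
    where
    open Weighted
    to-pair : Weighted (Greedy ⊤ (fOn G ⊤)) → ℚ × ElimTree G ⊤
    to-pair p = weight p , proj₁ (tree-of (valid p))
    weights≡ : ∀ ps → weights G (List.map to-pair ps) ≡ ∑ ps weight
    weights≡ []       = refl
    weights≡ (p ∷ ps) = cong (weight p +_) (weights≡ ps)
    combo≡ : ∀ ps u → combination ps u ≡ combo G (List.map to-pair ps) u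
    combo≡ []       u = refl
    combo≡ (p ∷ ps) u = cong₂ _+_ (cong (weight p *_) (proj₂ (tree-of (valid p)) SP.∈⊤)) (combo≡ ps u)

  InBase⇒InConvHull : ∀ {x} → InBase G x → InConvHull G x
  InBase⇒InConvHull {x} x∈B = InConv-Greedy⇒InConvHull
    (InBasePolytope⇒InConv-Greedy ⊤ (fOn G ⊤) x fOn⊤⊥≡0 (InBase⇒InBasePolytope {x} x∈B))

  InConvHull⇒InBase : ∀ {x} → InConvHull G x → InBase G x
  InConvHull⇒InBase {x} (ps , 0≤ps , Σps≡1 , x≗) = bounded , total
    where
    open QP.≤-Reasoning
    Σps≡1′ : ∑ ps proj₁ ≡ 1ℚ
    Σps≡1′ = trans (sym (weights≡∑ G ps)) Σps≡1
    x⟨⟩≡ : ∀ X → x ⟨ X ⟩ ≡ ∑ ps (λ p → proj₁ p * (xT G (proj₂ p)) ⟨ X ⟩)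
    x⟨⟩≡ X = trans (⟨⟩-cong X (λ {u} _ → x≗ u)) (⟨⟩-combo G ps X)
    bounded : ∀ X cs → Components G (∁ X) cs → x ⟨ X ⟩ ≤ℚ fval cs
    bounded X cs cs-comp = begin
      (x ⟨ X ⟩)
        ≡⟨ x⟨⟩≡ X ⟩
      ∑ ps (λ p → proj₁ p * (xT G (proj₂ p)) ⟨ X ⟩)
        ≤⟨ ∑-mono-≤ (All.map (λ {p} 0≤l → QP.*-monoˡ-≤-nonNeg (proj₁ p) {{nonNegative 0≤l}} (xT≤f (proj₂ p))) 0≤ps) ⟩
      ∑ ps (λ p → proj₁ p * fval cs)
        ≡⟨ ∑-*ʳ (fval cs) ps proj₁ ⟩
      ∑ ps proj₁ * fval cs
        ≡⟨ trans (cong (_* fval cs) Σps≡1′) (QP.*-identityˡ _) ⟩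
      fval cs ∎
      where
      xT≤f : ∀ t → (xT G t) ⟨ X ⟩ ≤ℚ fval cs
      xT≤f t = QP.≤-trans (xT-bound G t ⊤-connected X) (QP.≤-reflexive (sym (fval≡fOn cs-comp)))
    total : ∀ cs → Components G (∁ ⊤) cs → x ⟨ ⊤ ⟩ ≡ fval cs
    total cs cs-comp = begin-equality
      (x ⟨ ⊤ ⟩)
        ≡⟨ x⟨⟩≡ ⊤ ⟩
      ∑ ps (λ p → proj₁ p * (xT G (proj₂ p)) ⟨ ⊤ ⟩)
        ≡⟨ ∑-cong ps (λ p → cong (proj₁ p *_) (xT-total G (proj₂ p))) ⟩
      ∑ ps (λ p → proj₁ p * (w ∣ ⊤ {n} ∣))
        ≡⟨ ∑-*ʳ (w ∣ ⊤ {n} ∣) ps proj₁ ⟩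
      (∑ ps proj₁ * w ∣ ⊤ {n} ∣)
        ≡⟨ trans (cong (_* w ∣ ⊤ {n} ∣) Σps≡1′) (QP.*-identityˡ _) ⟩
      (w ∣ ⊤ {n} ∣)
        ≡⟨ QP.+-identityʳ _ ⟨
      (w ∣ ⊤ {n} ∣ - 0ℚ)
        ≡⟨ cong (λ c → w ∣ ⊤ {n} ∣ - c) (componentSum-empty G (λ (_ , x∈⊤∖⊤) → proj₂ (∖⁻ {p = ⊤} x∈⊤∖⊤) SP.∈⊤)) ⟨
      fOn G ⊤ ⊤
        ≡⟨ fval≡fOn cs-comp ⟨
      fval cs ∎

lemma6 : (n : ℕ) (G : Graph n) → 2 ≤ n → Connected G →
         (x : Fin n → ℚ) → (InBase G x ⇔ InConvHull G x)
lemma6 (suc m) G _ G-conn x = mk⇔ (InBase⇒InConvHull G G-conn) (InConvHull⇒InBase G G-conn)
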